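{- Let $S$ be a nonempty finite set and $\mu\colon\mathscr P(S)\to\mathbb Z$ a submodular, non-decreasing function. Let $P_\mu=\{\mathbf x\in\mathbb R^S:\mathbf x\ge\mathbf 0,\ \mathbf x\cdot\mathbf i_U\le\mu(U)\text{ for all }U\subseteq S\}$ and $B_\mu=\{\mathbf x\in P_\mu:\mathbf x\cdot\mathbf i_S=\mu(S)\}$. Fix any linear order on $S$ and write $I_\mu(\xi)=\sum_{j\ge0}c_j\xi^j$ and $X_\mu(\eta)=\sum_{j\ge0}c'_j\eta^j$. Then for every nonnegative integer $k$, \[\big|(B_\mu+k\nabla_S)\cap\mathbb Z^S\big|=\sum_{j=0}^{|S|-1}c_j\binom{k+|S|-1-j}{|S|-1-j},\qquad \big|(B_\mu+k\Delta_S)\cap\mathbb Z^S\big|=\sum_{j=0}^{|S|-1}c'_j\binom{k+|S|-1-j}{|S|-1-j}.\] (In particular $I_\mu$ and $X_\mu$ do not depend on the order.)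
   Context: $\mathbf i_U$ denotes the indicator vector of $U\subseteq S$; $+$ between sets is Minkowski sum. $\nabla_S=\operatorname{conv}\{ -\mathbf i_{\{s\}}:s\in S\}$ (inverted standard simplex) and $\Delta_S=\operatorname{conv}\{\mathbf i_{\{s\}}:s\in S\}$. Let $\mathcal B=B_\mu\cap\mathbb Z^S$ (the bases). For a linear order on $S$ and $\mathbf f\in\mathcal B$: $s\in S$ is internally active if there is no $t<s$ with $\mathbf f-\mathbf i_{\{s\}}+\mathbf i_{\{t\}}\in\mathcal B$, and externally active if there is no $t<s$ with $\mathbf f+\mathbf i_{\{s\}}-\mathbf i_{\{t\}}\in\mathcal B$. Let $\bar\iota(\mathbf f)$, $\bar\epsilon(\mathbf f)$ be the numbers of elements of $S$ that are not internally, resp. not externally, active. The interior and exterior polynomials are $I_\mu(\xi)=\sum_{\mathbf f\in\mathcal B}\xi^{\bar\iota(\mathbf f)}$ and $X_\mu(\eta)=\sum_{\mathbf f\in\mathcal B}\eta^{\bar\epsilon(\mathbf f)}$.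
   Formalization: The polytopes $P_\mu$, $B_\mu$, $\nabla_S$ and $\Delta_S$ consist of points of ℚ^S rather than ℝ^S, and so do the Minkowski sums $B_\mu+k\nabla_S$ and $B_\mu+k\Delta_S$. -}

module Defs where

open import Data.Nat as ℕ using (ℕ; zero; suc; _∸_)
open import Data.Nat.Combinatorics using (_C_)
open import Data.Integer as ℤ using (ℤ)
open import Data.Rational as ℚ using (ℚ; 0ℚ; 1ℚ; _/_)
open import Data.Fin as Fin using (Fin; zero; suc; _≟_)
open import Data.Fin.Subset using (Subset; Side; inside; outside; _∪_; _∩_; _⊆_; ⊤)
open import Data.Vec as Vec using (Vec; lookup; tabulate)
open import Data.List as List using (List; length; map; upTo)
open import Data.Nat.ListAction using (sum)
open import Data.List.Membership.Propositional using (_∈_)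
open import Data.List.Relation.Unary.Unique.Propositional using (Unique)
open import Data.Product using (Σ; Σ-syntax; ∃; ∃-syntax; _×_)
open import Data.Bool using (if_then_else_)
open import Relation.Nullary using (¬_)
open import Relation.Nullary.Decidable using (⌊_⌋)
open import Relation.Binary.PropositionalEquality using (_≡_)
open import Function.Definitions using (Injective)

Card : {A : Set} → (A → Set) → ℕ → Set
Card {A} P m = Σ[ L ∈ List A ] (Unique L × (∀ a → (a ∈ L → P a) × (P a → a ∈ L)) × length L ≡ m)

sumℚ : ∀ {n} → (Fin n → ℚ) → ℚ
sumℚ {zero} f = 0ℚ
sumℚ {suc n} f = f zero ℚ.+ sumℚ (λ i → f (suc i))

toℚ : ℤ → ℚ
toℚ z = z / 1

dot : ∀ {n} → Subset n → (Fin n → ℚ) → ℚ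
dot U x = sumℚ (λ i → sel (lookup U i) (x i))
  where
  sel : Side → ℚ → ℚ
  sel inside q = q
  sel outside q = 0ℚ

Submodular : ∀ {n} → (Subset n → ℤ) → Set
Submodular μ = ∀ A B → μ (A ∪ B) ℤ.+ μ (A ∩ B) ℤ.≤ μ A ℤ.+ μ B

NonDecreasing : ∀ {n} → (Subset n → ℤ) → Set
NonDecreasing μ = ∀ A B → A ⊆ B → μ A ℤ.≤ μ B

InP : ∀ {n} → (Subset n → ℤ) → (Fin n → ℚ) → Set
InP μ x = (∀ i → 0ℚ ℚ.≤ x i) × (∀ U → dot U x ℚ.≤ toℚ (μ U))

InB : ∀ {n} → (Subset n → ℤ) → (Fin n → ℚ) → Set
InB μ x = InP μ x × (dot ⊤ x ≡ toℚ (μ ⊤))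

vecℚ : ∀ {n} → Vec ℤ n → Fin n → ℚ
vecℚ f i = toℚ (lookup f i)

IsBase : ∀ {n} → (Subset n → ℤ) → Vec ℤ n → Set
IsBase μ f = InB μ (vecℚ f)

-- ∇_S = conv{-i_{s}} and Δ_S = conv{i_{s}} (convex combinations of the vertices)
InNabla : ∀ {n} → (Fin n → ℚ) → Set
InNabla {n} y = Σ[ λ' ∈ (Fin n → ℚ) ] ((∀ s → 0ℚ ℚ.≤ λ' s) × sumℚ λ' ≡ 1ℚ × (∀ i → y i ≡ ℚ.- λ' i))

InDelta : ∀ {n} → (Fin n → ℚ) → Set
InDelta {n} y = Σ[ λ' ∈ (Fin n → ℚ) ] ((∀ s → 0ℚ ℚ.≤ λ' s) × sumℚ λ' ≡ 1ℚ × (∀ i → y i ≡ λ' i))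

InMinkowski : ∀ {n} → (Subset n → ℤ) → ℕ → ((Fin n → ℚ) → Set) → Vec ℤ n → Set
InMinkowski {n} μ k Q z =
  Σ[ x ∈ (Fin n → ℚ) ] Σ[ y ∈ (Fin n → ℚ) ]
    (InB μ x × Q y × (∀ i → vecℚ z i ≡ x i ℚ.+ (ℤ.+ k / 1) ℚ.* y i))

e : ∀ {n} → Fin n → Vec ℤ n
e s = tabulate (λ i → if ⌊ s ≟ i ⌋ then ℤ.+ 1 else ℤ.+ 0)

_⊕_ _⊖_ : ∀ {n} → Vec ℤ n → Vec ℤ n → Vec ℤ n
f ⊕ g = Vec.zipWith ℤ._+_ f g
f ⊖ g = Vec.zipWith ℤ._-_ f g

LinOrd : ℕ → Set
LinOrd n = Σ[ rank ∈ (Fin n → Fin n) ] Injective _≡_ _≡_ rank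

_<[_]_ : ∀ {n} → Fin n → LinOrd n → Fin n → Set
t <[ (rank Data.Product., _) ] s = rank t Fin.< rank s

InternallyActive : ∀ {n} → (Subset n → ℤ) → LinOrd n → Vec ℤ n → Fin n → Set
InternallyActive μ o f s = ¬ (∃[ t ] (t <[ o ] s × IsBase μ ((f ⊖ e s) ⊕ e t)))

ExternallyActive : ∀ {n} → (Subset n → ℤ) → LinOrd n → Vec ℤ n → Fin n → Set
ExternallyActive μ o f s = ¬ (∃[ t ] (t <[ o ] s × IsBase μ ((f ⊕ e s) ⊖ e t)))

ιbar≡ : ∀ {n} → (Subset n → ℤ) → LinOrd n → Vec ℤ n → ℕ → Set
ιbar≡ μ o f m = Card (λ s → ¬ InternallyActive μ o f s) m

εbar≡ : ∀ {n} → (Subset n → ℤ) → LinOrd n → Vec ℤ n → ℕ → Set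
εbar≡ μ o f m = Card (λ s → ¬ ExternallyActive μ o f s) m

-- c j = coefficient of ξ^j in I_μ ; c' j = coefficient of η^j in X_μ
InteriorCoeffs : ∀ {n} → (Subset n → ℤ) → LinOrd n → (ℕ → ℕ) → Set
InteriorCoeffs μ o c = ∀ j → Card (λ f → IsBase μ f × ιbar≡ μ o f j) (c j)

ExteriorCoeffs : ∀ {n} → (Subset n → ℤ) → LinOrd n → (ℕ → ℕ) → Set
ExteriorCoeffs μ o c = ∀ j → Card (λ f → IsBase μ f × εbar≡ μ o f j) (c j)

-- Σ_{j=0}^{m} c_j · binom(k+m-j, m-j)   (here m = |S| - 1)
ehrhartSum : ℕ → (ℕ → ℕ) → ℕ → ℕ
ehrhartSum m c k = sum (map (λ j → c j ℕ.* ((k ℕ.+ (m ∸ j)) C (m ∸ j))) (upTo (suc m)))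

-- The integer points of B_μ form an M-convex set: the tight sets of an integral base are closed
-- under ∪ and ∩ (submodularity), and moving a unit between coordinates through the smallest or
-- largest suitable tight set gives the two exchange properties. An integer point z lies in
-- B_μ + k∇ exactly when it lies k units (in total) below an integral base; the rational
-- witness is turned into an integral one by greedily raising a point of P_μ inside a box.
-- Among the bases above z exactly one, f, has its slack f − z supported on internally active
-- elements: it is reached by repeatedly moving units to smaller elements (a rank-weighted
-- potential drops), and it is unique by exchanging at the first coordinate where two
-- candidates differ. So the points are partitioned by f, and a base with ῑ(f) = j has |S| − j
-- active elements over which the k units are distributed freely, giving
-- binom(k + |S| − 1 − j, |S| − 1 − j) points. For B_μ + kΔ the same argument runs on the
-- negated bases, whose internal activity is the external activity of the bases.

module Submission where

open import Defs
open import Data.Nat as ℕ using (ℕ; zero; suc; _∸_; z≤n; s≤s)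
import Data.Nat.Properties as ℕP
open import Data.Nat.Combinatorics using (_C_; nCn≡1; nCk+nC[k+1]≡[n+1]C[k+1])
open import Data.Nat.ListAction using (sum)
open import Data.Integer as ℤ using (ℤ; +_; 0ℤ; 1ℤ; _+_; _-_; -_; _*_; _≤_; _<_)
import Data.Integer.Properties as ℤP
open import Data.Integer.Tactic.RingSolver using (solve-∀)
open import Algebra.Properties.CommutativeMonoid.Sum ℤP.+-0-commutativeMonoid
  using (sum-cong-≗; ∑-distrib-+; sum-replicate-zero) renaming (sum to Σℤ)
open import Data.Nat.Coprimality using (1-coprimeTo)
open import Data.Rational as ℚ using (ℚ; 0ℚ; 1ℚ; mkℚ; toℚᵘ)
import Data.Rational.Properties as ℚP
import Data.Rational.Unnormalised as ℚᵘ
import Data.Rational.Unnormalised.Properties as ℚᵘP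
open import Data.Rational.Solver using (module +-*-Solver)
open +-*-Solver using (_:+_; _:=_; con) renaming (solve to solveℚ)
open import Data.Fin as Fin using (Fin; zero; suc; _≟_; toℕ)
import Data.Fin.Properties as FinP
open import Data.Fin.Subset
  using (Subset; Side; inside; outside; _∪_; _∩_; ⊤; ⊥; ∁; ⁅_⁆; _∈_; _∉_; _⊆_; ∣_∣)
open import Data.Fin.Subset.Properties
  using (_∈?_; ∈⊤; ∉⊥; x∈p∩q⁺; x∈p∩q⁻; x∈p∪q⁻; x∈∁p⇒x∉p; x∉p⇒x∈∁p; p⊆p∪q; q⊆p∪q;
         ∩-identityʳ; ∪-identityʳ; anySubset?; ∣p∣≤n; ∣∁p∣≡n∸∣p∣; x∈p⇒∣p-x∣<∣p∣)
open import Data.Vec as Vec using (Vec; []; _∷_; lookup; tabulate; here; there)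
import Data.Vec.Properties as VecP
open import Data.Bool using (true; false; if_then_else_; _∧_; _∨_; not)
open import Data.List as List using (List; []; _∷_; _++_; length)
import Data.List.Properties as ListP
import Data.List.Membership.Propositional as L
open import Data.List.Membership.Propositional.Properties using (∈-map⁺; ∈-map⁻; ∈-++⁺ˡ; ∈-++⁺ʳ; ∈-++⁻; ∈-upTo⁺)
open import Data.List.Membership.Propositional.Properties.WithK using (unique∧set⇒bag)
open import Data.List.Relation.Binary.BagAndSetEquality using (∼bag⇒↭)
open import Data.List.Relation.Binary.Permutation.Propositional.Properties using (↭-length)
import Data.List.Relation.Unary.Any as LAny
import Data.List.Relation.Unary.All as All
open import Data.List.Relation.Unary.AllPairs using ([]; _∷_)
open import Data.List.Relation.Unary.Unique.Propositional using (Unique)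
import Data.List.Relation.Unary.Unique.Propositional.Properties as Unique
open import Data.Product using (Σ-syntax; ∃-syntax; _×_; _,_; proj₁; proj₂)
open import Data.Sum as Sum using (_⊎_; inj₁; inj₂; [_,_])
open import Data.Empty as Empty using (⊥-elim)
open import Data.Unit using (tt) renaming (⊤ to Unit)
open import Function using (_∘′_)
open import Function.Bundles using (mk⇔)
open import Relation.Nullary using (¬_; Dec; yes; no; does; contradiction)
open import Relation.Nullary.Decidable using (⌊_⌋; map′; _×-dec_; ¬?; decidable-stable; dec-true; dec-false)
open import Relation.Unary using (Decidable)
open import Relation.Binary using (tri<; tri≈; tri>)
open import Relation.Binary.PropositionalEquality hiding ([_])

private
  variable
    n : ℕ

-- Integer vectors and the pairing ⟨ U , f ⟩ = f · i_U

vec-ext : ∀ {A : Set} {f g : Vec A n} → (∀ i → lookup f i ≡ lookup g i) → f ≡ g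
vec-ext {f = f} {g} p = trans (sym (VecP.tabulate∘lookup f)) (trans (VecP.tabulate-cong p) (VecP.tabulate∘lookup g))

Σℤ-neg : (f : Fin n → ℤ) → Σℤ (λ i → - f i) ≡ - Σℤ f
Σℤ-neg {zero} f = refl
Σℤ-neg {suc n} f = trans (cong (λ w → - f zero + w) (Σℤ-neg (λ i → f (suc i)))) (sym (ℤP.neg-distrib-+ (f zero) _))

Σℤ-distrib-- : (f g : Fin n → ℤ) → Σℤ (λ i → f i - g i) ≡ Σℤ f - Σℤ g
Σℤ-distrib-- f g = trans (∑-distrib-+ f (λ i → - g i)) (cong (λ w → Σℤ f + w) (Σℤ-neg g))

Σℤ-mono-≤ : {f g : Fin n → ℤ} → (∀ i → f i ≤ g i) → Σℤ f ≤ Σℤ g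
Σℤ-mono-≤ {zero} p = ℤP.≤-refl
Σℤ-mono-≤ {suc n} p = ℤP.+-mono-≤ (p zero) (Σℤ-mono-≤ (λ i → p (suc i)))

δ : Fin n → Fin n → ℤ
δ s i = if ⌊ s ≟ i ⌋ then 1ℤ else 0ℤ

δ-≢ : {s i : Fin n} → s ≢ i → δ s i ≡ 0ℤ
δ-≢ {s = s} {i} s≢i with s ≟ i
... | yes s≡i = contradiction s≡i s≢i
... | no _ = refl

δ-suc : (s i : Fin n) → δ (suc s) (suc i) ≡ δ s i
δ-suc s i with s ≟ i
... | yes refl = refl
... | no _ = refl

0≤δ : (s i : Fin n) → 0ℤ ≤ δ s i
0≤δ s i with s ≟ i
... | yes _ = ℤ.+≤+ z≤n
... | no _ = ℤ.+≤+ z≤n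

Σℤ-δ* : (s : Fin n) (g : Fin n → ℤ) → Σℤ (λ i → δ s i * g i) ≡ g s
Σℤ-δ* {suc n} zero g = begin
  1ℤ * g zero + Σℤ (λ i → 0ℤ * g (suc i)) ≡⟨ cong (λ w → 1ℤ * g zero + w) (trans (sum-cong-≗ (λ i → ℤP.*-zeroˡ (g (suc i)))) (sum-replicate-zero n)) ⟩
  1ℤ * g zero + 0ℤ                        ≡⟨ trans (ℤP.+-identityʳ _) (ℤP.*-identityˡ _) ⟩
  g zero                                  ∎
  where open ≡-Reasoning
Σℤ-δ* {suc n} (suc s) g = trans (ℤP.+-identityˡ _) (trans (sum-cong-≗ (λ i → cong (_* g (suc i)) (δ-suc s i))) (Σℤ-δ* s (λ i → g (suc i))))

lookup-e : (s i : Fin n) → lookup (e s) i ≡ δ s i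
lookup-e s i = VecP.lookup∘tabulate _ i

lookup-⊕ : (f g : Vec ℤ n) (i : Fin n) → lookup (f ⊕ g) i ≡ lookup f i + lookup g i
lookup-⊕ f g i = VecP.lookup-zipWith _+_ i f g

lookup-⊖ : (f g : Vec ℤ n) (i : Fin n) → lookup (f ⊖ g) i ≡ lookup f i - lookup g i
lookup-⊖ f g i = VecP.lookup-zipWith _-_ i f g

mask : Side → ℤ → ℤ
mask inside x = x
mask outside x = 0ℤ

⟨_,_⟩ : Subset n → Vec ℤ n → ℤ
⟨ U , f ⟩ = Σℤ (λ i → mask (lookup U i) (lookup f i))

mask-∈ : {U : Subset n} {i : Fin n} (x : ℤ) → i ∈ U → mask (lookup U i) x ≡ x
mask-∈ x i∈U rewrite VecP.[]=⇒lookup i∈U = refl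

mask-∉ : {U : Subset n} {i : Fin n} (x : ℤ) → i ∉ U → mask (lookup U i) x ≡ 0ℤ
mask-∉ {U = U} {i} x i∉U with lookup U i in eq
... | inside = contradiction (VecP.lookup⇒[]= i U eq) i∉U
... | outside = refl

mask-+ : ∀ b x y → mask b (x + y) ≡ mask b x + mask b y
mask-+ inside x y = refl
mask-+ outside x y = refl

mask-- : ∀ b x y → mask b (x - y) ≡ mask b x - mask b y
mask-- inside x y = refl
mask-- outside x y = refl

mask-modular : ∀ a b x → mask (a ∨ b) x + mask (a ∧ b) x ≡ mask a x + mask b x
mask-modular inside inside x = refl
mask-modular inside outside x = refl
mask-modular outside inside x = trans (ℤP.+-identityʳ x) (sym (ℤP.+-identityˡ x))
mask-modular outside outside x = refl

mask-not : ∀ b x → mask b x + mask (not b) x ≡ x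
mask-not inside x = ℤP.+-identityʳ x
mask-not outside x = ℤP.+-identityˡ x

⟨⟩-⊕ : (U : Subset n) (f g : Vec ℤ n) → ⟨ U , f ⊕ g ⟩ ≡ ⟨ U , f ⟩ + ⟨ U , g ⟩
⟨⟩-⊕ U f g = trans (sum-cong-≗ (λ i → trans (cong (mask (lookup U i)) (lookup-⊕ f g i)) (mask-+ (lookup U i) _ _)))
  (∑-distrib-+ (λ i → mask (lookup U i) (lookup f i)) (λ i → mask (lookup U i) (lookup g i)))

⟨⟩-⊖ : (U : Subset n) (f g : Vec ℤ n) → ⟨ U , f ⊖ g ⟩ ≡ ⟨ U , f ⟩ - ⟨ U , g ⟩
⟨⟩-⊖ U f g = trans (sum-cong-≗ (λ i → trans (cong (mask (lookup U i)) (lookup-⊖ f g i)) (mask-- (lookup U i) _ _)))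
  (Σℤ-distrib-- (λ i → mask (lookup U i) (lookup f i)) (λ i → mask (lookup U i) (lookup g i)))

⟨⟩-e : (U : Subset n) (s : Fin n) → ⟨ U , e s ⟩ ≡ mask (lookup U s) 1ℤ
⟨⟩-e U s = trans (sum-cong-≗ (λ i → trans (cong (mask (lookup U i)) (lookup-e s i)) (mask-δ (lookup U i) (δ s i))))
  (Σℤ-δ* s (λ i → mask (lookup U i) 1ℤ))
  where
  mask-δ : ∀ b x → mask b x ≡ x * mask b 1ℤ
  mask-δ inside x = sym (ℤP.*-identityʳ x)
  mask-δ outside x = sym (ℤP.*-zeroʳ x)

⟨⟩-e-∈ : {U : Subset n} {s : Fin n} → s ∈ U → ⟨ U , e s ⟩ ≡ 1ℤ
⟨⟩-e-∈ {U = U} {s} s∈U = trans (⟨⟩-e U s) (mask-∈ 1ℤ s∈U)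

⟨⟩-e-∉ : {U : Subset n} {s : Fin n} → s ∉ U → ⟨ U , e s ⟩ ≡ 0ℤ
⟨⟩-e-∉ {U = U} {s} s∉U = trans (⟨⟩-e U s) (mask-∉ 1ℤ s∉U)

⟨⟩-mono : (U : Subset n) {f g : Vec ℤ n} → (∀ i → i ∈ U → lookup f i ≤ lookup g i) → ⟨ U , f ⟩ ≤ ⟨ U , g ⟩
⟨⟩-mono U {f} {g} f≤g = Σℤ-mono-≤ masked
  where
  masked : ∀ i → mask (lookup U i) (lookup f i) ≤ mask (lookup U i) (lookup g i)
  masked i with i ∈? U
  ... | yes i∈U rewrite mask-∈ (lookup f i) i∈U | mask-∈ (lookup g i) i∈U = f≤g i i∈U
  ... | no i∉U rewrite mask-∉ (lookup f i) i∉U | mask-∉ (lookup g i) i∉U = ℤP.≤-refl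

⟨⟩-modular : (A B : Subset n) (f : Vec ℤ n) → ⟨ A ∪ B , f ⟩ + ⟨ A ∩ B , f ⟩ ≡ ⟨ A , f ⟩ + ⟨ B , f ⟩
⟨⟩-modular A B f = begin
  ⟨ A ∪ B , f ⟩ + ⟨ A ∩ B , f ⟩
    ≡⟨ sym (∑-distrib-+ (λ i → mask (lookup (A ∪ B) i) (lookup f i)) (λ i → mask (lookup (A ∩ B) i) (lookup f i))) ⟩
  Σℤ (λ i → mask (lookup (A ∪ B) i) (lookup f i) + mask (lookup (A ∩ B) i) (lookup f i))
    ≡⟨ sum-cong-≗ (λ i → trans (cong₂ (λ a b → mask a (lookup f i) + mask b (lookup f i))
          (VecP.lookup-zipWith _∨_ i A B) (VecP.lookup-zipWith _∧_ i A B)) (mask-modular (lookup A i) (lookup B i) _)) ⟩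
  Σℤ (λ i → mask (lookup A i) (lookup f i) + mask (lookup B i) (lookup f i))
    ≡⟨ ∑-distrib-+ (λ i → mask (lookup A i) (lookup f i)) (λ i → mask (lookup B i) (lookup f i)) ⟩
  ⟨ A , f ⟩ + ⟨ B , f ⟩ ∎
  where open ≡-Reasoning

⟨⊤⟩≡Σ : (f : Vec ℤ n) → ⟨ ⊤ , f ⟩ ≡ Σℤ (lookup f)
⟨⊤⟩≡Σ f = sum-cong-≗ (λ i → cong (λ b → mask b (lookup f i)) (VecP.lookup-replicate i inside))

⟨⊥⟩≡0 : {n : ℕ} (f : Vec ℤ n) → ⟨ ⊥ , f ⟩ ≡ 0ℤ
⟨⊥⟩≡0 {n} f = trans (sum-cong-≗ (λ i → cong (λ b → mask b (lookup f i)) (VecP.lookup-replicate i outside))) (sum-replicate-zero n)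

⟨⟩-∁ : (T : Subset n) (f : Vec ℤ n) → ⟨ T , f ⟩ + ⟨ ∁ T , f ⟩ ≡ ⟨ ⊤ , f ⟩
⟨⟩-∁ T f = begin
  ⟨ T , f ⟩ + ⟨ ∁ T , f ⟩
    ≡⟨ sym (∑-distrib-+ (λ i → mask (lookup T i) (lookup f i)) (λ i → mask (lookup (∁ T) i) (lookup f i))) ⟩
  Σℤ (λ i → mask (lookup T i) (lookup f i) + mask (lookup (∁ T) i) (lookup f i))
    ≡⟨ sum-cong-≗ (λ i → trans (cong (λ b → mask (lookup T i) (lookup f i) + mask b (lookup f i)) (VecP.lookup-map i not T))
                                (mask-not (lookup T i) (lookup f i))) ⟩
  Σℤ (lookup f)
    ≡⟨ sym (⟨⊤⟩≡Σ f) ⟩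
  ⟨ ⊤ , f ⟩ ∎
  where open ≡-Reasoning

infix 4 _≤ᵛ_

_≤ᵛ_ : Vec ℤ n → Vec ℤ n → Set
f ≤ᵛ g = ∀ i → lookup f i ≤ lookup g i

move : Vec ℤ n → Fin n → Fin n → Vec ℤ n
move f s t = (f ⊖ e s) ⊕ e t

lookup-move : (f : Vec ℤ n) (s t i : Fin n) → lookup (move f s t) i ≡ lookup f i - δ s i + δ t i
lookup-move f s t i = trans (lookup-⊕ (f ⊖ e s) (e t) i)
  (cong₂ _+_ (trans (lookup-⊖ f (e s) i) (cong (λ w → lookup f i - w) (lookup-e s i))) (lookup-e t i))

⟨⟩-move : (U : Subset n) (f : Vec ℤ n) (s t : Fin n) → ⟨ U , move f s t ⟩ ≡ ⟨ U , f ⟩ - ⟨ U , e s ⟩ + ⟨ U , e t ⟩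
⟨⟩-move U f s t = trans (⟨⟩-⊕ U (f ⊖ e s) (e t)) (cong (λ w → w + ⟨ U , e t ⟩) (⟨⟩-⊖ U f (e s)))

⟨⊤⟩-move : (f : Vec ℤ n) (s t : Fin n) → ⟨ ⊤ , move f s t ⟩ ≡ ⟨ ⊤ , f ⟩
⟨⊤⟩-move f s t = trans (⟨⟩-move ⊤ f s t) (trans (cong₂ (λ a b → ⟨ ⊤ , f ⟩ - a + b) (⟨⟩-e-∈ {U = ⊤} {s} ∈⊤) (⟨⟩-e-∈ {U = ⊤} {t} ∈⊤)) (cancel ⟨ ⊤ , f ⟩))
  where
  cancel : ∀ a → a - 1ℤ + 1ℤ ≡ a
  cancel = solve-∀

<⇒+1≤ : ∀ {a b} → a < b → a + 1ℤ ≤ b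
<⇒+1≤ {a} a<b = subst (_≤ _) (ℤP.+-comm 1ℤ a) (ℤP.i<j⇒suc[i]≤j a<b)

+1≤⇒< : ∀ {a b} → a + 1ℤ ≤ b → a < b
+1≤⇒< {a} a+1≤b = ℤP.suc[i]≤j⇒i<j (subst (_≤ _) (ℤP.+-comm a 1ℤ) a+1≤b)

≤ᵛ-⊕e : (y : Vec ℤ n) (i : Fin n) → y ≤ᵛ y ⊕ e i
≤ᵛ-⊕e y i j rewrite lookup-⊕ y (e i) j | lookup-e i j =
  subst (_≤ lookup y j + δ i j) (ℤP.+-identityʳ (lookup y j)) (ℤP.+-monoʳ-≤ (lookup y j) (0≤δ i j))

⊕e-≤ᵛ : ∀ {y Z : Vec ℤ n} {i} → y ≤ᵛ Z → lookup y i < lookup Z i → y ⊕ e i ≤ᵛ Z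
⊕e-≤ᵛ {y = y} {Z} {i} y≤Z yi<Zi j rewrite lookup-⊕ y (e i) j | lookup-e i j with i ≟ j
... | yes refl = <⇒+1≤ yi<Zi
... | no _ = subst (_≤ lookup Z j) (sym (ℤP.+-identityʳ _)) (y≤Z j)

⟨⊤⟩-⊕e : (y : Vec ℤ n) (i : Fin n) → ⟨ ⊤ , y ⊕ e i ⟩ ≡ ⟨ ⊤ , y ⟩ + 1ℤ
⟨⊤⟩-⊕e y i = trans (⟨⟩-⊕ ⊤ y (e i)) (cong (λ w → ⟨ ⊤ , y ⟩ + w) (⟨⟩-e-∈ {U = ⊤} {i} ∈⊤))

≤-complement : ∀ {a b c d} → a + b ≡ c + d → a ≤ c → d ≤ b
≤-complement {a} {b} {c} {d} eq a≤c = ℤP.0≤i-j⇒j≤i (subst (0ℤ ≤_) c-a≡b-d (ℤP.i≤j⇒0≤j-i a≤c))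
  where
  c-a≡b-d : c - a ≡ b - d
  c-a≡b-d = begin
    c - a             ≡⟨ shift₁ a c d ⟩
    (c + d) - (a + d) ≡⟨ cong (_- (a + d)) (sym eq) ⟩
    (a + b) - (a + d) ≡⟨ shift₂ a b d ⟩
    b - d             ∎
    where
    open ≡-Reasoning
    shift₁ : ∀ a c d → c - a ≡ (c + d) - (a + d)
    shift₁ = solve-∀
    shift₂ : ∀ a b d → (a + b) - (a + d) ≡ b - d
    shift₂ = solve-∀

⟨⟩-mono-< : (T : Subset n) {f g : Vec ℤ n} {s : Fin n} →
            (∀ i → i ∈ T → lookup f i ≤ lookup g i) → s ∈ T → lookup f s < lookup g s → ⟨ T , f ⟩ < ⟨ T , g ⟩
⟨⟩-mono-< T {f} {g} {s} f≤g s∈T fs<gs = +1≤⇒< (begin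
  ⟨ T , f ⟩ + 1ℤ          ≡⟨ cong (λ w → ⟨ T , f ⟩ + w) (sym (⟨⟩-e-∈ {U = T} {s} s∈T)) ⟩
  ⟨ T , f ⟩ + ⟨ T , e s ⟩ ≡⟨ sym (⟨⟩-⊕ T f (e s)) ⟩
  ⟨ T , f ⊕ e s ⟩         ≤⟨ ⟨⟩-mono T {f ⊕ e s} {g} raised≤g ⟩
  ⟨ T , g ⟩               ∎)
  where
  open ℤP.≤-Reasoning
  raised≤g : ∀ i → i ∈ T → lookup (f ⊕ e s) i ≤ lookup g i
  raised≤g i i∈T rewrite lookup-⊕ f (e s) i | lookup-e s i with s ≟ i
  ... | yes refl = <⇒+1≤ fs<gs
  ... | no _ = subst (_≤ lookup g i) (sym (ℤP.+-identityʳ (lookup f i))) (f≤g i i∈T)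

exceeds-within : (T : Subset n) (f g : Vec ℤ n) {s : Fin n} →
                 s ∈ T → lookup g s < lookup f s → ⟨ T , f ⟩ ≤ ⟨ T , g ⟩ → ∃[ t ] (t ∈ T × lookup f t < lookup g t)
exceeds-within T f g s∈T gs<fs Tf≤Tg with FinP.any? (λ t → (t ∈? T) ×-dec (lookup f t ℤP.<? lookup g t))
... | yes found = found
... | no none = contradiction Tf≤Tg (ℤP.<⇒≱ (⟨⟩-mono-< T {g} {f} g≤f s∈T gs<fs))
  where
  g≤f : ∀ i → i ∈ T → lookup g i ≤ lookup f i
  g≤f i i∈T = ℤP.≮⇒≥ (λ fi<gi → none (i , i∈T , fi<gi))

neg : Vec ℤ n → Vec ℤ n
neg = Vec.map (λ x → - x)

lookup-neg : (f : Vec ℤ n) (i : Fin n) → lookup (neg f) i ≡ - lookup f i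
lookup-neg f i = VecP.lookup-map i (λ x → - x) f

neg-involutive : (f : Vec ℤ n) → neg (neg f) ≡ f
neg-involutive f = vec-ext (λ i → trans (lookup-neg (neg f) i) (trans (cong (λ x → - x) (lookup-neg f i)) (ℤP.neg-involutive _)))

neg-injective : {f g : Vec ℤ n} → neg f ≡ neg g → f ≡ g
neg-injective {f = f} {g} eq = trans (sym (neg-involutive f)) (trans (cong neg eq) (neg-involutive g))

neg-mono-≤ᵛ : {f g : Vec ℤ n} → f ≤ᵛ g → neg g ≤ᵛ neg f
neg-mono-≤ᵛ {f = f} {g} f≤g i = subst₂ _≤_ (sym (lookup-neg g i)) (sym (lookup-neg f i)) (ℤP.neg-mono-≤ (f≤g i))

⟨⊤⟩-map+ : (d : Vec ℕ n) → ⟨ ⊤ , Vec.map +_ d ⟩ ≡ + Vec.sum d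
⟨⊤⟩-map+ [] = refl
⟨⊤⟩-map+ (x ∷ d) = trans (cong (λ w → + x + w) (⟨⊤⟩-map+ d)) (sym (ℤP.pos-+ x (Vec.sum d)))

⟨⊤⟩-nonneg : (d : Vec ℤ n) → (∀ i → 0ℤ ≤ lookup d i) → 0ℤ ≤ ⟨ ⊤ , d ⟩
⟨⊤⟩-nonneg [] d≥0 = ℤP.≤-refl
⟨⊤⟩-nonneg (x ∷ d) d≥0 = ℤP.+-mono-≤ (d≥0 zero) (⟨⊤⟩-nonneg d (λ i → d≥0 (suc i)))

nonneg-sum-zero : (d : Vec ℤ n) → (∀ i → 0ℤ ≤ lookup d i) → ⟨ ⊤ , d ⟩ ≡ 0ℤ → ∀ i → lookup d i ≡ 0ℤ
nonneg-sum-zero (x ∷ d) d≥0 sum≡0 = λ { zero → x≡0 ; (suc i) → nonneg-sum-zero d (λ i → d≥0 (suc i)) rest≡0 i }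
  where
  x≤0 : x ≤ 0ℤ
  x≤0 = subst₂ _≤_ (ℤP.+-identityʳ x) sum≡0 (ℤP.+-monoʳ-≤ x (⟨⊤⟩-nonneg d (λ i → d≥0 (suc i))))
  x≡0 : x ≡ 0ℤ
  x≡0 = ℤP.≤-antisym x≤0 (d≥0 zero)
  rest≡0 : ⟨ ⊤ , d ⟩ ≡ 0ℤ
  rest≡0 = trans (sym (ℤP.+-identityˡ ⟨ ⊤ , d ⟩)) (trans (cong (_+ ⟨ ⊤ , d ⟩) (sym x≡0)) sum≡0)

⟨⊤⟩-neg : (f : Vec ℤ n) → ⟨ ⊤ , neg f ⟩ ≡ - ⟨ ⊤ , f ⟩
⟨⊤⟩-neg [] = refl
⟨⊤⟩-neg (x ∷ f) = trans (cong (λ w → - x + w) (⟨⊤⟩-neg f)) (sym (ℤP.neg-distrib-+ x ⟨ ⊤ , f ⟩))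

neg-move : (f : Vec ℤ n) (s t : Fin n) → neg (move f s t) ≡ move (neg f) t s
neg-move f s t = vec-ext (λ i → begin
  lookup (neg (move f s t)) i        ≡⟨ trans (lookup-neg (move f s t) i) (cong (λ x → - x) (lookup-move f s t i)) ⟩
  - (lookup f i - δ s i + δ t i)     ≡⟨ swap (lookup f i) (δ s i) (δ t i) ⟩
  - lookup f i - δ t i + δ s i       ≡⟨ cong (λ w → w - δ t i + δ s i) (sym (lookup-neg f i)) ⟩
  lookup (neg f) i - δ t i + δ s i  ≡⟨ sym (lookup-move (neg f) t s i) ⟩
  lookup (move (neg f) t s) i        ∎)
  where
  open ≡-Reasoning
  swap : ∀ a b c → - (a - b + c) ≡ - a - c + b
  swap = solve-∀

⊕⊖≡move : (f : Vec ℤ n) (s t : Fin n) → (f ⊕ e s) ⊖ e t ≡ move f t s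
⊕⊖≡move f s t = vec-ext (λ i → begin
  lookup ((f ⊕ e s) ⊖ e t) i        ≡⟨ trans (lookup-⊖ (f ⊕ e s) (e t) i) (cong₂ _-_ (lookup-⊕ f (e s) i) (lookup-e t i)) ⟩
  lookup f i + lookup (e s) i - δ t i ≡⟨ cong (λ w → lookup f i + w - δ t i) (lookup-e s i) ⟩
  lookup f i + δ s i - δ t i        ≡⟨ swap (lookup f i) (δ s i) (δ t i) ⟩
  lookup f i - δ t i + δ s i        ≡⟨ sym (lookup-move f t s i) ⟩
  lookup (move f t s) i             ∎)
  where
  open ≡-Reasoning
  swap : ∀ a b c → a + b - c ≡ a - c + b
  swap = solve-∀

-- Counting with Card

Card-⇔ : {A : Set} {P Q : A → Set} {m : ℕ} → (∀ a → P a → Q a) → (∀ a → Q a → P a) → Card P m → Card Q m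
Card-⇔ P⇒Q Q⇒P (L , L! , L∈ , L#) = L , L! , (λ a → (λ a∈L → P⇒Q a (proj₁ (L∈ a) a∈L)) , (λ Qa → proj₂ (L∈ a) (Q⇒P a Qa))) , L#

card-unique : {A : Set} {P : A → Set} {m m′ : ℕ} → Card P m → Card P m′ → m ≡ m′
card-unique (L , L! , L∈ , refl) (L′ , L′! , L′∈ , refl) =
  ↭-length (∼bag⇒↭ (unique∧set⇒bag L! L′! (mk⇔ (λ a∈L → proj₂ (L′∈ _) (proj₁ (L∈ _) a∈L))
                                                (λ a∈L′ → proj₂ (L∈ _) (proj₁ (L′∈ _) a∈L′)))))

Card-image : {A B : Set} {P : A → Set} {m : ℕ} (g : A → B) → (∀ {a a′} → g a ≡ g a′ → a ≡ a′) →
             Card P m → Card (λ b → ∃[ a ] (P a × g a ≡ b)) m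
Card-image g g-inj (L , L! , L∈ , L#) = List.map g L , Unique.map⁺ g-inj L! , image∈ , trans (ListP.length-map g L) L#
  where
  image∈ : ∀ b → (b L.∈ List.map g L → ∃[ a ] (_ × g a ≡ b)) × (∃[ a ] (_ × g a ≡ b) → b L.∈ List.map g L)
  image∈ b = (λ b∈ → let a , a∈L , b≡ga = ∈-map⁻ g b∈ in a , proj₁ (L∈ a) a∈L , sym b≡ga)
           , (λ (a , Pa , ga≡b) → subst (L._∈ List.map g L) ga≡b (∈-map⁺ g (proj₂ (L∈ a) Pa)))

Card-⋃ : {I B : Set} {Q : I → B → Set} {w : I → ℕ} (xs : List I) → Unique xs →
         (∀ {i} → i L.∈ xs → Card (Q i) (w i)) →
         (∀ {i i′ b} → i L.∈ xs → i′ L.∈ xs → Q i b → Q i′ b → i ≡ i′) →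
         Card (λ b → ∃[ i ] (i L.∈ xs × Q i b)) (sum (List.map w xs))
Card-⋃ [] _ _ _ = [] , [] , (λ b → (λ ()) , (λ ())) , refl
Card-⋃ {Q = Q} {w} (x ∷ xs) (x∉xs ∷ xs!) cards disjoint with cards (LAny.here refl) | Card-⋃ xs xs! (λ i∈ → cards (LAny.there i∈)) (λ i∈ i′∈ → disjoint (LAny.there i∈) (LAny.there i′∈))
... | L , L! , L∈ , L# | R , R! , R∈ , R# = L ++ R , Unique.++⁺ L! R! L∩R≡∅ , ∈L++R , trans (ListP.length-++ L) (cong₂ ℕ._+_ L# R#)
  where
  L∩R≡∅ : ∀ {b} → ¬ (b L.∈ L × b L.∈ R)
  L∩R≡∅ {b} (b∈L , b∈R) with proj₁ (R∈ b) b∈R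
  ... | i , i∈xs , Qib = All.lookup x∉xs i∈xs (disjoint (LAny.here refl) (LAny.there i∈xs) (proj₁ (L∈ b) b∈L) Qib)
  ∈L++R : ∀ b → (b L.∈ L ++ R → ∃[ i ] (i L.∈ x ∷ xs × Q i b)) × (∃[ i ] (i L.∈ x ∷ xs × Q i b) → b L.∈ L ++ R)
  ∈L++R b = [ (λ b∈L → x , LAny.here refl , proj₁ (L∈ b) b∈L) , (λ b∈R → let i , i∈ , Qib = proj₁ (R∈ b) b∈R in i , LAny.there i∈ , Qib) ]
            ∘′ ∈-++⁻ L
          , λ { (i , LAny.here refl , Qib) → ∈-++⁺ˡ (proj₂ (L∈ b) Qib) ; (i , LAny.there i∈ , Qib) → ∈-++⁺ʳ L (proj₂ (R∈ b) (i , i∈ , Qib)) }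

sum-map-const : {A : Set} (K : ℕ) (xs : List A) → sum (List.map (λ _ → K) xs) ≡ length xs ℕ.* K
sum-map-const K [] = refl
sum-map-const K (x ∷ xs) = cong (K ℕ.+_) (sum-map-const K xs)

Card-⊎ : {A : Set} {P Q : A → Set} {a b : ℕ} → Card P a → Card Q b → (∀ x → P x → ¬ Q x) → Card (λ x → P x ⊎ Q x) (a ℕ.+ b)
Card-⊎ {P = P} {Q} (L , L! , L∈ , L#) (R , R! , R∈ , R#) P∩Q≡∅ =
  L ++ R , Unique.++⁺ L! R! (λ (x∈L , x∈R) → P∩Q≡∅ _ (proj₁ (L∈ _) x∈L) (proj₁ (R∈ _) x∈R))
  , (λ x → (λ x∈ → Sum.map (proj₁ (L∈ x)) (proj₁ (R∈ x)) (∈-++⁻ L x∈)) , [ (λ Px → ∈-++⁺ˡ (proj₂ (L∈ x) Px)) , (λ Qx → ∈-++⁺ʳ L (proj₂ (R∈ x) Qx)) ])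
  , trans (ListP.length-++ L) (cong₂ ℕ._+_ L# R#)

Card-singleton : {A : Set} (x : A) → Card (_≡ x) 1
Card-singleton x = x ∷ [] , All.[] ∷ [] , (λ y → (λ { (LAny.here y≡x) → y≡x }) , (λ y≡x → LAny.here y≡x)) , refl

members-card : (p : Subset n) → Card (_∈ p) ∣ p ∣
members-card [] = [] , [] , (λ _ → (λ ()) , (λ ())) , refl
members-card (outside ∷ p) = Card-⇔ (λ { _ (i , i∈p , refl) → there i∈p }) (λ { zero () ; (suc i) (there i∈p) → i , i∈p , refl })
                                    (Card-image suc FinP.suc-injective (members-card p))
members-card (inside ∷ p) =
  Card-⇔ (λ { _ (inj₁ refl) → here ; _ (inj₂ (i , i∈p , refl)) → there i∈p })
         (λ { zero here → inj₁ refl ; (suc i) (there i∈p) → inj₂ (i , i∈p , refl) })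
         (Card-⊎ (Card-singleton zero) (Card-image suc FinP.suc-injective (members-card p)) (λ { _ refl (_ , _ , ()) }))

IsComposition : Subset n → ℕ → Vec ℕ n → Set
IsComposition A k d = (∀ i → i ∉ A → lookup d i ≡ 0) × Vec.sum d ≡ k

compositionCount : ℕ → ℕ → ℕ
compositionCount zero zero = 1
compositionCount zero (suc k) = 0
compositionCount (suc a) zero = compositionCount a zero
compositionCount (suc a) (suc k) = compositionCount a (suc k) ℕ.+ compositionCount (suc a) k

∷-injectiveʳ : ∀ {x : ℕ} {d d′ : Vec ℕ n} → x ∷ d ≡ x ∷ d′ → d ≡ d′
∷-injectiveʳ refl = refl

off-0∷ : ∀ {A : Subset n} {s d} → (∀ i → i ∉ A → lookup d i ≡ 0) → ∀ i → i ∉ s ∷ A → lookup (0 ∷ d) i ≡ 0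
off-0∷ off zero _ = refl
off-0∷ off (suc i) i∉ = off i (λ i∈ → i∉ (there i∈))

off-tail : ∀ {A : Subset n} {s x d} → (∀ i → i ∉ s ∷ A → lookup (x ∷ d) i ≡ 0) → ∀ i → i ∉ A → lookup d i ≡ 0
off-tail off i i∉ = off (suc i) (λ { (there i∈) → i∉ i∈ })

incHead : Vec ℕ (suc n) → Vec ℕ (suc n)
incHead (x ∷ d) = suc x ∷ d

incHead-injective : ∀ {d d′ : Vec ℕ (suc n)} → incHead d ≡ incHead d′ → d ≡ d′
incHead-injective {d = _ ∷ _} {_ ∷ _} refl = refl

compositions-card : (A : Subset n) (k : ℕ) → Card (IsComposition A k) (compositionCount ∣ A ∣ k)
compositions-card [] zero = [] ∷ [] , All.[] ∷ [] , (λ { [] → (λ _ → (λ ()) , refl) , (λ _ → LAny.here refl) }) , refl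
compositions-card [] (suc k) = [] , [] , (λ { [] → (λ ()) , (λ ()) }) , refl
compositions-card (outside ∷ A) k = Card-⇔ from to (Card-image (0 ∷_) ∷-injectiveʳ (compositions-card A k))
  where
  from : ∀ d → ∃[ d′ ] (IsComposition A k d′ × 0 ∷ d′ ≡ d) → IsComposition (outside ∷ A) k d
  from _ (d′ , (off , sum≡) , refl) = off-0∷ off , sum≡
  to : ∀ d → IsComposition (outside ∷ A) k d → ∃[ d′ ] (IsComposition A k d′ × 0 ∷ d′ ≡ d)
  to (x ∷ d′) (off , sum≡) with off zero (λ ())
  ... | refl = d′ , (off-tail off , sum≡) , refl
compositions-card (inside ∷ A) zero = Card-⇔ from to (Card-image (0 ∷_) ∷-injectiveʳ (compositions-card A zero))
  where
  from : ∀ d → ∃[ d′ ] (IsComposition A zero d′ × 0 ∷ d′ ≡ d) → IsComposition (inside ∷ A) zero d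
  from _ (d′ , (off , sum≡) , refl) = off-0∷ off , sum≡
  to : ∀ d → IsComposition (inside ∷ A) zero d → ∃[ d′ ] (IsComposition A zero d′ × 0 ∷ d′ ≡ d)
  to (zero ∷ d′) (off , sum≡) = d′ , (off-tail off , sum≡) , refl
compositions-card (inside ∷ A) (suc k) =
  Card-⇔ from to (Card-⊎ (Card-image (0 ∷_) ∷-injectiveʳ (compositions-card A (suc k)))
                         (Card-image incHead incHead-injective (compositions-card (inside ∷ A) k)) disjoint)
  where
  Left Right : Vec ℕ (suc _) → Set
  Left d = ∃[ d′ ] (IsComposition A (suc k) d′ × 0 ∷ d′ ≡ d)
  Right d = ∃[ d′ ] (IsComposition (inside ∷ A) k d′ × incHead d′ ≡ d)
  disjoint : ∀ d → Left d → ¬ Right d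
  disjoint _ (_ , _ , refl) ((_ ∷ _) , _ , ())
  from : ∀ d → Left d ⊎ Right d → IsComposition (inside ∷ A) (suc k) d
  from _ (inj₁ (d′ , (off , sum≡) , refl)) = off-0∷ off , sum≡
  from _ (inj₂ ((x ∷ d′) , (off , sum≡) , refl)) = (λ { zero i∉ → contradiction here i∉ ; (suc i) i∉ → off (suc i) i∉ }) , cong suc sum≡
  to : ∀ d → IsComposition (inside ∷ A) (suc k) d → Left d ⊎ Right d
  to (zero ∷ d′) (off , sum≡) = inj₁ (d′ , (off-tail off , sum≡) , refl)
  to (suc x ∷ d′) (off , sum≡) = inj₂ (x ∷ d′ , ((λ { zero i∉ → contradiction here i∉ ; (suc i) i∉ → off (suc i) i∉ }) , ℕP.suc-injective sum≡) , refl)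

compositionCount-C : ∀ a k → compositionCount (suc a) k ≡ (k ℕ.+ a) C a
compositionCount-C zero zero = refl
compositionCount-C zero (suc k) = compositionCount-C zero k
compositionCount-C (suc a) zero = trans (compositionCount-C a zero) (trans (nCn≡1 a) (sym (nCn≡1 (suc a))))
compositionCount-C (suc a) (suc k) = begin
  compositionCount (suc a) (suc k) ℕ.+ compositionCount (suc (suc a)) k
    ≡⟨ cong₂ ℕ._+_ (compositionCount-C a (suc k)) (compositionCount-C (suc a) k) ⟩
  (suc k ℕ.+ a) C a ℕ.+ (k ℕ.+ suc a) C suc a
    ≡⟨ cong (λ x → (suc k ℕ.+ a) C a ℕ.+ x C suc a) (ℕP.+-suc k a) ⟩
  (suc k ℕ.+ a) C a ℕ.+ (suc k ℕ.+ a) C suc a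
    ≡⟨ nCk+nC[k+1]≡[n+1]C[k+1] (suc k ℕ.+ a) a ⟩
  suc (suc k ℕ.+ a) C suc a
    ≡⟨ cong (λ x → x C suc a) (sym (ℕP.+-suc (suc k) a)) ⟩
  (suc k ℕ.+ suc a) C suc a ∎
  where open ≡-Reasoning

-- Integer points of the polymatroid

allSubsets : ∀ n → List (Subset n)
allSubsets zero = [] ∷ []
allSubsets (suc n) = List.map (inside ∷_) (allSubsets n) ++ List.map (outside ∷_) (allSubsets n)

∈-allSubsets : (U : Subset n) → U L.∈ allSubsets n
∈-allSubsets [] = LAny.here refl
∈-allSubsets (inside ∷ U) = ∈-++⁺ˡ (∈-map⁺ (inside ∷_) (∈-allSubsets U))
∈-allSubsets {suc n} (outside ∷ U) = ∈-++⁺ʳ (List.map (inside ∷_) (allSubsets n)) (∈-map⁺ (outside ∷_) (∈-allSubsets U))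

∉-∪ : ∀ {u : Fin n} {A B} → u ∉ A → u ∉ B → u ∉ A ∪ B
∉-∪ {A = A} {B} u∉A u∉B u∈A∪B = [ u∉A , u∉B ] (x∈p∪q⁻ A B u∈A∪B)

∀-subset? : {P : Subset n → Set} → Decidable P → Dec (∀ U → P U)
∀-subset? P? with anySubset? (λ U → ¬? (P? U))
... | yes (U , ¬PU) = no (λ ∀P → ¬PU (∀P U))
... | no ∄¬P = yes (λ U → decidable-stable (P? U) (λ ¬PU → ∄¬P (U , ¬PU)))

module Closure {P : Subset n → Set} (P? : Decidable P) where

  ⋂ᴸ ⋃ᴸ : List (Subset n) → Subset n
  ⋂ᴸ [] = ⊤
  ⋂ᴸ (U ∷ Us) = if does (P? U) then U ∩ ⋂ᴸ Us else ⋂ᴸ Us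
  ⋃ᴸ [] = ⊥
  ⋃ᴸ (U ∷ Us) = if does (P? U) then U ∪ ⋃ᴸ Us else ⋃ᴸ Us

  ⋂ᴸ-closed : (∀ {A B} → P A → P B → P (A ∩ B)) → ∀ Us → P (⋂ᴸ Us) ⊎ ⋂ᴸ Us ≡ ⊤
  ⋂ᴸ-closed closed [] = inj₂ refl
  ⋂ᴸ-closed closed (U ∷ Us) with P? U | ⋂ᴸ-closed closed Us
  ... | yes PU | inj₁ P⋂ = inj₁ (closed PU P⋂)
  ... | yes PU | inj₂ ⋂≡⊤ = inj₁ (subst P (sym (trans (cong (U ∩_) ⋂≡⊤) (∩-identityʳ U))) PU)
  ... | no _ | rest = rest

  ⋂ᴸ-lower : ∀ {U} Us → U L.∈ Us → P U → ⋂ᴸ Us ⊆ U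
  ⋂ᴸ-lower (V ∷ Us) (LAny.here refl) PV x∈ with P? V
  ... | yes _ = proj₁ (x∈p∩q⁻ V _ x∈)
  ... | no ¬PV = contradiction PV ¬PV
  ⋂ᴸ-lower (V ∷ Us) (LAny.there U∈) PU x∈ with P? V
  ... | yes _ = ⋂ᴸ-lower Us U∈ PU (proj₂ (x∈p∩q⁻ V _ x∈))
  ... | no _ = ⋂ᴸ-lower Us U∈ PU x∈

  ⋃ᴸ-closed : (∀ {A B} → P A → P B → P (A ∪ B)) → ∀ Us → P (⋃ᴸ Us) ⊎ ⋃ᴸ Us ≡ ⊥
  ⋃ᴸ-closed closed [] = inj₂ refl
  ⋃ᴸ-closed closed (U ∷ Us) with P? U | ⋃ᴸ-closed closed Us
  ... | yes PU | inj₁ P⋃ = inj₁ (closed PU P⋃)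
  ... | yes PU | inj₂ ⋃≡⊥ = inj₁ (subst P (sym (trans (cong (U ∪_) ⋃≡⊥) (∪-identityʳ U))) PU)
  ... | no _ | rest = rest

  ⋃ᴸ-upper : ∀ {U} Us → U L.∈ Us → P U → U ⊆ ⋃ᴸ Us
  ⋃ᴸ-upper (V ∷ Us) (LAny.here refl) PV x∈ with P? V
  ... | yes _ = p⊆p∪q _ x∈
  ... | no ¬PV = contradiction PV ¬PV
  ⋃ᴸ-upper (V ∷ Us) (LAny.there U∈) PU x∈ with P? V
  ... | yes _ = q⊆p∪q V _ (⋃ᴸ-upper Us U∈ PU x∈)
  ... | no _ = ⋃ᴸ-upper Us U∈ PU x∈

  ⋂ ⋃ : Subset n
  ⋂ = ⋂ᴸ (allSubsets n)
  ⋃ = ⋃ᴸ (allSubsets n)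

  ⋂-closed : (∀ {A B} → P A → P B → P (A ∩ B)) → P ⋂ ⊎ ⋂ ≡ ⊤
  ⋂-closed closed = ⋂ᴸ-closed closed (allSubsets n)

  ⋂-lower : ∀ {U} → P U → ⋂ ⊆ U
  ⋂-lower {U} = ⋂ᴸ-lower (allSubsets n) (∈-allSubsets U)

  ⋃-closed : (∀ {A B} → P A → P B → P (A ∪ B)) → P ⋃ ⊎ ⋃ ≡ ⊥
  ⋃-closed closed = ⋃ᴸ-closed closed (allSubsets n)

  ⋃-upper : ∀ {U} → P U → U ⊆ ⋃
  ⋃-upper {U} = ⋃ᴸ-upper (allSubsets n) (∈-allSubsets U)

module Polymatroid (μ : Subset n → ℤ) where

  record InPℤ (y : Vec ℤ n) : Set where
    constructor inPℤ
    field
      nonneg : ∀ i → 0ℤ ≤ lookup y i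
      bounded : ∀ U → ⟨ U , y ⟩ ≤ μ U

  record Baseℤ (y : Vec ℤ n) : Set where
    constructor baseℤ
    field
      inP : InPℤ y
      total : ⟨ ⊤ , y ⟩ ≡ μ ⊤

  open InPℤ public
  open Baseℤ public

  baseℤ? : Decidable Baseℤ
  baseℤ? y = map′ (λ ((nn , b) , t) → baseℤ (inPℤ nn b) t) (λ (baseℤ (inPℤ nn b) t) → (nn , b) , t)
    ((FinP.all? (λ i → 0ℤ ℤP.≤? lookup y i) ×-dec ∀-subset? (λ U → ⟨ U , y ⟩ ℤP.≤? μ U)) ×-dec (⟨ ⊤ , y ⟩ ℤP.≟ μ ⊤))

  Tight : Vec ℤ n → Subset n → Set
  Tight y U = μ U ≤ ⟨ U , y ⟩

  tight? : (y : Vec ℤ n) → Decidable (Tight y)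
  tight? y U = μ U ℤP.≤? ⟨ U , y ⟩

  base⇒tight-⊤ : ∀ {y} → Baseℤ y → Tight y ⊤
  base⇒tight-⊤ yB = ℤP.≤-reflexive (sym (total yB))

  ⟨⟩-≤-tight : ∀ {f} g U → InPℤ f → Tight g U → ⟨ U , f ⟩ ≤ ⟨ U , g ⟩
  ⟨⟩-≤-tight g U fP tight = ℤP.≤-trans (bounded fP U) tight

  module Submodularity (sub : Submodular μ) {y : Vec ℤ n} (yP : InPℤ y) where

    private
      modular-bound : ∀ {A B} → Tight y A → Tight y B → μ (A ∪ B) + μ (A ∩ B) ≤ ⟨ A ∪ B , y ⟩ + ⟨ A ∩ B , y ⟩
      modular-bound {A} {B} tA tB = ℤP.≤-trans (sub A B) (ℤP.≤-trans (ℤP.+-mono-≤ tA tB) (ℤP.≤-reflexive (sym (⟨⟩-modular A B y))))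

      cancelʳ : ∀ {a b c d} → a + b ≤ c + d → d ≤ b → a ≤ c
      cancelʳ {a} {b} {c} {d} a+b≤c+d d≤b =
        subst₂ _≤_ (cancel a b) (cancel c d) (ℤP.+-mono-≤ a+b≤c+d (ℤP.neg-mono-≤ d≤b))
        where
        cancel : ∀ x y → x + y - y ≡ x
        cancel = solve-∀

    tight-∪ : ∀ {A B} → Tight y A → Tight y B → Tight y (A ∪ B)
    tight-∪ {A} {B} tA tB = cancelʳ (modular-bound tA tB) (bounded yP (A ∩ B))

    tight-∩ : ∀ {A B} → Tight y A → Tight y B → Tight y (A ∩ B)
    tight-∩ {A} {B} tA tB =
      cancelʳ (subst₂ _≤_ (ℤP.+-comm (μ (A ∪ B)) (μ (A ∩ B))) (ℤP.+-comm ⟨ A ∪ B , y ⟩ ⟨ A ∩ B , y ⟩) (modular-bound tA tB))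
              (bounded yP (A ∪ B))

  module Exchange (sub : Submodular μ) where

    move-base : ∀ {g a b} → Baseℤ g → 0ℤ < lookup g a → a ≢ b → (∀ U → Tight g U → b ∈ U → a ∈ U) →
                Baseℤ (move g a b)
    move-base {g} {a} {b} (baseℤ (inPℤ g≥0 g≤μ) sum≡μ) ga>0 a≢b b∈⇒a∈ = baseℤ (inPℤ nonneg′ bounded′) (trans (⟨⊤⟩-move g a b) sum≡μ)
      where
      nonneg′ : ∀ i → 0ℤ ≤ lookup (move g a b) i
      nonneg′ i rewrite lookup-move g a b i with a ≟ i
      ... | yes refl rewrite δ-≢ {s = b} {i = a} (λ b≡a → a≢b (sym b≡a)) =
        subst (0ℤ ≤_) (sym (ℤP.+-identityʳ (lookup g a - 1ℤ))) (ℤP.i≤j⇒0≤j-i (ℤP.i<j⇒suc[i]≤j ga>0))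
      ... | no _ = ℤP.+-mono-≤ (subst (0ℤ ≤_) (sym (ℤP.+-identityʳ (lookup g i))) (g≥0 i)) (0≤δ b i)
      bounded′ : ∀ U → ⟨ U , move g a b ⟩ ≤ μ U
      bounded′ U rewrite ⟨⟩-move U g a b with b ∈? U | a ∈? U
      ... | no b∉U | yes a∈U rewrite ⟨⟩-e-∉ {U = U} b∉U | ⟨⟩-e-∈ {U = U} a∈U =
        ℤP.≤-trans (ℤP.≤-reflexive (ℤP.+-identityʳ _)) (ℤP.i≤j⇒i-k≤j 1ℤ (g≤μ U))
      ... | no b∉U | no a∉U rewrite ⟨⟩-e-∉ {U = U} b∉U | ⟨⟩-e-∉ {U = U} a∉U =
        ℤP.≤-trans (ℤP.≤-reflexive (ℤP.+-identityʳ _)) (ℤP.i≤j⇒i-k≤j 0ℤ (g≤μ U))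
      ... | yes b∈U | yes a∈U rewrite ⟨⟩-e-∈ {U = U} b∈U | ⟨⟩-e-∈ {U = U} a∈U =
        ℤP.≤-trans (ℤP.≤-reflexive (cancel ⟨ U , g ⟩)) (g≤μ U)
        where
        cancel : ∀ x → x - 1ℤ + 1ℤ ≡ x
        cancel = solve-∀
      ... | yes b∈U | no a∉U rewrite ⟨⟩-e-∈ {U = U} b∈U | ⟨⟩-e-∉ {U = U} a∉U =
        subst (λ w → w + 1ℤ ≤ μ U) (sym (ℤP.+-identityʳ ⟨ U , g ⟩))
              (<⇒+1≤ (ℤP.≰⇒> (λ tight → a∉U (b∈⇒a∈ U tight b∈U))))

    module _ {y : Vec ℤ n} (yB : Baseℤ y) (s : Fin n) where
      open Closure (λ U → tight? y U ×-dec s ∈? U)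
      open Submodularity sub (inP yB)

      smallest-tight∋ : Σ[ T ∈ Subset n ] (Tight y T × s ∈ T × (∀ {U} → Tight y U → s ∈ U → T ⊆ U))
      smallest-tight∋ = ⋂ , proj₁ P⋂ , proj₂ P⋂ , (λ tU s∈U → ⋂-lower (tU , s∈U))
        where
        tight∋ : (Tight y ⋂ × s ∈ ⋂) ⊎ ⋂ ≡ ⊤ → Tight y ⋂ × s ∈ ⋂
        tight∋ (inj₁ P⋂) = P⋂
        tight∋ (inj₂ ⋂≡⊤) rewrite ⋂≡⊤ = base⇒tight-⊤ yB , ∈⊤
        P⋂ : Tight y ⋂ × s ∈ ⋂
        P⋂ = tight∋ (⋂-closed (λ (tA , sA) (tB , sB) → tight-∩ tA tB , x∈p∩q⁺ (sA , sB)))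

    module _ {y : Vec ℤ n} (yP : InPℤ y) {Q : Subset n → Set} (Q? : Decidable Q)
             (Q-∪ : ∀ {A B} → Q A → Q B → Q (A ∪ B)) where
      open Closure (λ U → tight? y U ×-dec Q? U)
      open Submodularity sub yP

      -- ⊥ need not be tight, since μ ⊥ may be positive.
      largest-tight : Σ[ T ∈ Subset n ] ((Tight y T × Q T) ⊎ T ≡ ⊥) × (∀ {U} → Tight y U → Q U → U ⊆ T)
      largest-tight = ⋃ , ⋃-closed (λ (tA , qA) (tB , qB) → tight-∪ tA tB , Q-∪ qA qB) , (λ tU qU → ⋃-upper (tU , qU))

    exchangeᴵ : ∀ {f g s} → Baseℤ f → Baseℤ g → lookup g s < lookup f s →
                ∃[ t ] (lookup f t < lookup g t × Baseℤ (move g t s))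
    exchangeᴵ {f} {g} {s} fB gB gs<fs = through (smallest-tight∋ gB s)
      where
      through : Σ[ T ∈ Subset n ] (Tight g T × s ∈ T × (∀ {U} → Tight g U → s ∈ U → T ⊆ U)) →
                ∃[ t ] (lookup f t < lookup g t × Baseℤ (move g t s))
      through (T , T-tight , s∈T , T-least) = conclude (exceeds-within T f g s∈T gs<fs (⟨⟩-≤-tight g T (inP fB) T-tight))
        where
        conclude : ∃[ t ] (t ∈ T × lookup f t < lookup g t) → ∃[ t ] (lookup f t < lookup g t × Baseℤ (move g t s))
        conclude (t , t∈T , ft<gt) =
          t , ft<gt , move-base gB (ℤP.≤-<-trans (nonneg (inP fB) t) ft<gt) (λ { refl → ℤP.<-asym gs<fs ft<gt })
                                (λ U tU s∈U → T-least tU s∈U t∈T)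

    exchangeᴱ : ∀ {f g u} → Baseℤ f → Baseℤ g → lookup f u < lookup g u →
                ∃[ t ] (lookup g t < lookup f t × Baseℤ (move g u t))
    exchangeᴱ {f} {g} {u} fB gB fu<gu = through (largest-tight (inP gB) (λ U → ¬? (u ∈? U)) ∉-∪)
      where
      through : Σ[ T ∈ Subset n ] (((Tight g T × u ∉ T) ⊎ T ≡ ⊥) × (∀ {U} → Tight g U → u ∉ U → U ⊆ T)) →
                ∃[ t ] (lookup g t < lookup f t × Baseℤ (move g u t))
      through (T , T-tight⊎⊥ , T-largest) = conclude (exceeds-within (∁ T) g f (x∉p⇒x∈∁p u∉T) fu<gu ⟨∁T,g⟩≤⟨∁T,f⟩)
        where
        u∉T : u ∉ T
        u∉T = [ proj₂ , (λ T≡⊥ → subst (u ∉_) (sym T≡⊥) ∉⊥) ] T-tight⊎⊥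
        ⟨T,f⟩≤⟨T,g⟩ : ⟨ T , f ⟩ ≤ ⟨ T , g ⟩
        ⟨T,f⟩≤⟨T,g⟩ = [ (λ (T-tight , _) → ⟨⟩-≤-tight g T (inP fB) T-tight)
                      , (λ T≡⊥ → ℤP.≤-reflexive (subst (λ V → ⟨ V , f ⟩ ≡ ⟨ V , g ⟩) (sym T≡⊥) (trans (⟨⊥⟩≡0 f) (sym (⟨⊥⟩≡0 g))))) ]
                      T-tight⊎⊥
        ⟨∁T,g⟩≤⟨∁T,f⟩ : ⟨ ∁ T , g ⟩ ≤ ⟨ ∁ T , f ⟩
        ⟨∁T,g⟩≤⟨∁T,f⟩ = ≤-complement (trans (⟨⟩-∁ T f) (trans (total fB) (trans (sym (total gB)) (sym (⟨⟩-∁ T g)))))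
                                     ⟨T,f⟩≤⟨T,g⟩
        conclude : ∃[ t ] (t ∈ ∁ T × lookup g t < lookup f t) → ∃[ t ] (lookup g t < lookup f t × Baseℤ (move g u t))
        conclude (t , t∈∁T , gt<ft) =
          t , gt<ft , move-base gB (ℤP.≤-<-trans (nonneg (inP fB) u) fu<gu) (λ { refl → ℤP.<-asym fu<gu gt<ft }) t∈⇒u∈
          where
          t∈⇒u∈ : ∀ U → Tight g U → t ∈ U → u ∈ U
          t∈⇒u∈ U tU t∈U = decidable-stable (u ∈? U) (λ u∉U → x∈∁p⇒x∉p t∈∁T (T-largest tU u∉U t∈U))

    raise : ∀ {y i} → InPℤ y → (∀ {U} → Tight y U → i ∉ U) → InPℤ (y ⊕ e i)
    raise {y} {i} yP i∉tight = inPℤ nonneg′ bounded′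
      where
      nonneg′ : ∀ j → 0ℤ ≤ lookup (y ⊕ e i) j
      nonneg′ j rewrite lookup-⊕ y (e i) j | lookup-e i j = ℤP.+-mono-≤ (nonneg yP j) (0≤δ i j)
      bounded′ : ∀ U → ⟨ U , y ⊕ e i ⟩ ≤ μ U
      bounded′ U rewrite ⟨⟩-⊕ U y (e i) with i ∈? U
      ... | yes i∈U rewrite ⟨⟩-e-∈ {U = U} i∈U = <⇒+1≤ (ℤP.≰⇒> (λ tight → i∉tight tight i∈U))
      ... | no i∉U rewrite ⟨⟩-e-∉ {U = U} i∉U = subst (_≤ μ U) (sym (ℤP.+-identityʳ _)) (bounded yP U)

    module Augmentation (Z : Vec ℤ n) (cut : ∀ T → μ ⊤ ≤ μ T + ⟨ ∁ T , Z ⟩) (whole : μ ⊤ ≤ ⟨ ⊤ , Z ⟩) where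

      raise-below : ∀ {y} → InPℤ y → y ≤ᵛ Z → ⟨ ⊤ , y ⟩ < μ ⊤ →
                    ∃[ y′ ] (InPℤ y′ × y ≤ᵛ y′ × y′ ≤ᵛ Z × ⟨ ⊤ , y′ ⟩ ≡ ⟨ ⊤ , y ⟩ + 1ℤ)
      raise-below {y} yP y≤Z deficient = through (largest-tight yP (λ _ → yes tt) (λ _ _ → tt))
        where
        through : Σ[ T ∈ Subset n ] (((Tight y T × Unit) ⊎ T ≡ ⊥) × (∀ {U} → Tight y U → Unit → U ⊆ T)) →
                  ∃[ y′ ] (InPℤ y′ × y ≤ᵛ y′ × y′ ≤ᵛ Z × ⟨ ⊤ , y′ ⟩ ≡ ⟨ ⊤ , y ⟩ + 1ℤ)
        through (T , T-tight⊎⊥ , T-largest) with FinP.any? (λ i → ¬? (i ∈? T) ×-dec (lookup y i ℤP.<? lookup Z i))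
        ... | yes (i , i∉T , yi<Zi) =
          y ⊕ e i , raise yP (λ tU i∈U → i∉T (T-largest tU tt i∈U)) , ≤ᵛ-⊕e y i , ⊕e-≤ᵛ {y = y} {Z} y≤Z yi<Zi , ⟨⊤⟩-⊕e y i
        ... | no none = contradiction (full T-tight⊎⊥) (ℤP.<⇒≱ deficient)
          where
          Z≤y : ∀ i → i ∉ T → lookup Z i ≤ lookup y i
          Z≤y i i∉T = ℤP.≮⇒≥ (λ yi<Zi → none (i , i∉T , yi<Zi))
          full : (Tight y T × Unit) ⊎ T ≡ ⊥ → μ ⊤ ≤ ⟨ ⊤ , y ⟩
          full (inj₁ (T-tight , _)) = begin
            μ ⊤                     ≤⟨ cut T ⟩
            μ T + ⟨ ∁ T , Z ⟩       ≤⟨ ℤP.+-mono-≤ T-tight (⟨⟩-mono (∁ T) {Z} {y} (λ i i∈∁T → Z≤y i (x∈∁p⇒x∉p i∈∁T))) ⟩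
            ⟨ T , y ⟩ + ⟨ ∁ T , y ⟩ ≡⟨ ⟨⟩-∁ T y ⟩
            ⟨ ⊤ , y ⟩               ∎
            where open ℤP.≤-Reasoning
          full (inj₂ T≡⊥) = ℤP.≤-trans whole (⟨⟩-mono ⊤ {Z} {y} (λ i _ → Z≤y i (subst (i ∉_) (sym T≡⊥) ∉⊥)))

      augment : ∀ {y} → InPℤ y → y ≤ᵛ Z → ∃[ f ] (Baseℤ f × y ≤ᵛ f × f ≤ᵛ Z)
      augment {y} yP y≤Z = go ℤ.∣ μ ⊤ - ⟨ ⊤ , y ⟩ ∣ yP y≤Z (ℤP.≤-reflexive (begin
        μ ⊤                                 ≡⟨ split (μ ⊤) ⟨ ⊤ , y ⟩ ⟩
        ⟨ ⊤ , y ⟩ + (μ ⊤ - ⟨ ⊤ , y ⟩)       ≡⟨ cong (λ w → ⟨ ⊤ , y ⟩ + w) (sym (ℤP.0≤i⇒+∣i∣≡i (ℤP.i≤j⇒0≤j-i (bounded yP ⊤)))) ⟩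
        ⟨ ⊤ , y ⟩ + + ℤ.∣ μ ⊤ - ⟨ ⊤ , y ⟩ ∣ ∎))
        where
        open ≡-Reasoning
        split : ∀ a b → a ≡ b + (a - b)
        split = solve-∀
        go : ∀ (fuel : ℕ) {y} → InPℤ y → y ≤ᵛ Z → μ ⊤ ≤ ⟨ ⊤ , y ⟩ + + fuel → ∃[ f ] (Baseℤ f × y ≤ᵛ f × f ≤ᵛ Z)
        go fuel {y} yP y≤Z enough with μ ⊤ ℤP.≤? ⟨ ⊤ , y ⟩
        ... | yes full = y , baseℤ yP (ℤP.≤-antisym (bounded yP ⊤) full) , (λ _ → ℤP.≤-refl) , y≤Z
        go zero {y} yP y≤Z enough | no deficient = contradiction (subst (μ ⊤ ≤_) (ℤP.+-identityʳ _) enough) deficient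
        go (suc fuel) {y} yP y≤Z enough | no deficient =
          let y′ , y′P , y≤y′ , y′≤Z , sum≡ = raise-below yP y≤Z (ℤP.≰⇒> deficient)
              f , fB , y′≤f , f≤Z = go fuel y′P y′≤Z (subst (μ ⊤ ≤_) (shift {y′} sum≡) enough)
          in f , fB , (λ j → ℤP.≤-trans (y≤y′ j) (y′≤f j)) , f≤Z
          where
          shift : ∀ {y′} → ⟨ ⊤ , y′ ⟩ ≡ ⟨ ⊤ , y ⟩ + 1ℤ → ⟨ ⊤ , y ⟩ + + suc fuel ≡ ⟨ ⊤ , y′ ⟩ + + fuel
          shift sum≡ = trans (sym (ℤP.+-assoc ⟨ ⊤ , y ⟩ 1ℤ (+ fuel))) (cong (_+ + fuel) (sym sum≡))

-- Lattice points below a set with the exchange property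

module _ (o : LinOrd n) where

  private
    rank : Fin n → Fin n
    rank = proj₁ o

  least : {P : Fin n → Set} → Decidable P → ∀ {s} → P s → ∃[ s′ ] (P s′ × ∀ t → t <[ o ] s′ → ¬ P t)
  least {P} P? {s} Ps = descend n (ℕP.<⇒≤ (FinP.toℕ<n (rank s))) Ps
    where
    descend : ∀ k {s} → toℕ (rank s) ℕ.≤ k → P s → ∃[ s′ ] (P s′ × ∀ t → t <[ o ] s′ → ¬ P t)
    descend k {s} rank≤k Ps with FinP.any? (λ t → (rank t FinP.<? rank s) ×-dec P? t)
    ... | no none = s , Ps , λ t t<s Pt → none (t , t<s , Pt)
    descend zero {s} rank≤0 Ps | yes (t , t<s , Pt) = contradiction (ℕP.<-≤-trans t<s rank≤0) ℕP.n≮0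
    descend (suc k) {s} rank≤k Ps | yes (t , t<s , Pt) = descend k (ℕP.≤-pred (ℕP.≤-trans t<s rank≤k)) Pt

  <[]-connex : ∀ {s t} → s ≢ t → s <[ o ] t ⊎ t <[ o ] s
  <[]-connex {s} {t} s≢t with FinP.<-cmp (rank s) (rank t)
  ... | tri< s<t _ _ = inj₁ s<t
  ... | tri≈ _ rank≡ _ = contradiction (proj₂ o rank≡) s≢t
  ... | tri> _ _ t<s = inj₂ t<s

Exchange : (Vec ℤ n → Set) → Set
Exchange B = ∀ f g {s} → B f → B g → lookup g s < lookup f s → ∃[ t ] (lookup f t < lookup g t × B (move g t s))

module LatticePointsBelow {m : ℕ} (o : LinOrd (suc m)) {B : Vec ℤ (suc m) → Set} (B? : Decidable B)
                          (exchange : Exchange B) where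

  private
    rank : Fin (suc m) → Fin (suc m)
    rank = proj₁ o

  Improvable : Vec ℤ (suc m) → Fin (suc m) → Set
  Improvable f s = ∃[ t ] (t <[ o ] s × B (move f s t))

  improvable? : ∀ f → Decidable (Improvable f)
  improvable? f s = FinP.any? (λ t → (rank t FinP.<? rank s) ×-dec B? (move f s t))

  Active : Vec ℤ (suc m) → Fin (suc m) → Set
  Active f s = ¬ Improvable f s

  record Covers (z f : Vec ℤ (suc m)) : Set where
    field
      member : B f
      above : z ≤ᵛ f
      slack-active : ∀ i → lookup z i < lookup f i → Active f i

  open Covers

  ¬drop-at-first-difference : ∀ {z f g s} → Covers z f → Covers z g → (∀ t → t <[ o ] s → lookup f t ≡ lookup g t) →
                ¬ lookup g s < lookup f s
  ¬drop-at-first-difference {z} {f} {g} {s} cf cg agree gs<fs with exchange f g (member cf) (member cg) gs<fs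
  ... | t , ft<gt , moved = slack-active cg t (ℤP.≤-<-trans (above cf t) ft<gt) (s , s<t , moved)
    where
    s<t : s <[ o ] t
    s<t with <[]-connex o {s} {t} (λ { refl → ℤP.<-asym gs<fs ft<gt })
    ... | inj₁ s<t = s<t
    ... | inj₂ t<s = contradiction (agree t t<s) (ℤP.<⇒≢ ft<gt)

  covers-unique : ∀ {z f g} → Covers z f → Covers z g → f ≡ g
  covers-unique {z} {f} {g} cf cg = vec-ext agree
    where
    agree : ∀ i → lookup f i ≡ lookup g i
    agree i with lookup f i ℤP.≟ lookup g i
    ... | yes fi≡gi = fi≡gi
    ... | no fi≢gi with least o (λ i → ¬? (lookup f i ℤP.≟ lookup g i)) fi≢gi
    ...   | s , fs≢gs , below = ⊥-elim (first-difference fs≢gs (λ t t<s → decidable-stable (lookup f t ℤP.≟ lookup g t) (below t t<s)))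
      where
      first-difference : ∀ {s} → lookup f s ≢ lookup g s → (∀ t → t <[ o ] s → lookup f t ≡ lookup g t) → Empty.⊥
      first-difference {s} fs≢gs agree-below with ℤP.<-cmp (lookup f s) (lookup g s)
      ... | tri< fs<gs _ _ = ¬drop-at-first-difference cg cf (λ t t<s → sym (agree-below t t<s)) fs<gs
      ... | tri≈ _ fs≡gs _ = fs≢gs fs≡gs
      ... | tri> _ _ gs<fs = ¬drop-at-first-difference cf cg agree-below gs<fs

  private
    weight : Fin (suc m) → ℤ
    weight i = + toℕ (rank i)

  potential : Vec ℤ (suc m) → Vec ℤ (suc m) → ℤ
  potential z f = Σℤ (λ i → weight i * (lookup f i - lookup z i))

  potential-nonneg : ∀ {z f} → z ≤ᵛ f → 0ℤ ≤ potential z f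
  potential-nonneg {z} {f} z≤f = ℤP.≤-trans (ℤP.≤-reflexive (sym (sum-replicate-zero (suc m)))) (Σℤ-mono-≤ nonneg-term)
    where
    nonneg-term : ∀ i → 0ℤ ≤ weight i * (lookup f i - lookup z i)
    nonneg-term i = subst (_≤ weight i * (lookup f i - lookup z i)) (ℤP.*-zeroʳ (weight i))
                          (ℤP.*-monoˡ-≤-nonNeg (weight i) (ℤP.i≤j⇒0≤j-i (z≤f i)))

  potential-move : ∀ z f s t → potential z (move f s t) ≡ potential z f - weight s + weight t
  potential-move z f s t = begin
    potential z (move f s t)
      ≡⟨ sum-cong-≗ (λ i → trans (cong (λ x → weight i * (x - lookup z i)) (lookup-move f s t i))
                                 (expand (weight i) (lookup f i) (lookup z i) (δ s i) (δ t i))) ⟩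
    Σℤ (λ i → weight i * (lookup f i - lookup z i) - δ s i * weight i + δ t i * weight i)
      ≡⟨ ∑-distrib-+ (λ i → weight i * (lookup f i - lookup z i) - δ s i * weight i) (λ i → δ t i * weight i) ⟩
    Σℤ (λ i → weight i * (lookup f i - lookup z i) - δ s i * weight i) + Σℤ (λ i → δ t i * weight i)
      ≡⟨ cong₂ _+_ (Σℤ-distrib-- (λ i → weight i * (lookup f i - lookup z i)) (λ i → δ s i * weight i)) (Σℤ-δ* t weight) ⟩
    potential z f - Σℤ (λ i → δ s i * weight i) + weight t
      ≡⟨ cong (λ x → potential z f - x + weight t) (Σℤ-δ* s weight) ⟩
    potential z f - weight s + weight t ∎
    where
    open ≡-Reasoning
    expand : ∀ w x y a b → w * (x - a + b - y) ≡ w * (x - y) - a * w + b * w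
    expand = solve-∀

  move-down : ∀ {z f s t} → z ≤ᵛ f → lookup z s < lookup f s → t <[ o ] s →
              z ≤ᵛ move f s t × potential z (move f s t) < potential z f
  move-down {z} {f} {s} {t} z≤f zs<fs t<s = z≤moved , decrease
    where
    t≢s : t ≢ s
    t≢s refl = ℕP.<-irrefl refl t<s
    z≤moved : z ≤ᵛ move f s t
    z≤moved i rewrite lookup-move f s t i with s ≟ i
    ... | yes refl rewrite δ-≢ t≢s = subst (lookup z s ≤_) (pred-form (lookup f s)) (ℤP.i<j⇒i≤pred[j] zs<fs)
      where
      pred-form : ∀ x → ℤ.-1ℤ + x ≡ x - 1ℤ + 0ℤ
      pred-form = solve-∀
    ... | no _ = ℤP.≤-trans (z≤f i) (subst (_≤ lookup f i - 0ℤ + δ t i) (drop-zeros (lookup f i))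
                                           (ℤP.+-monoʳ-≤ (lookup f i - 0ℤ) (0≤δ t i)))
      where
      drop-zeros : ∀ x → x - 0ℤ + 0ℤ ≡ x
      drop-zeros = solve-∀
    decrease : potential z (move f s t) < potential z f
    decrease = begin-strict
      potential z (move f s t)                        ≡⟨ potential-move z f s t ⟩
      potential z f - weight s + weight t             ≡⟨ regroup (potential z f) (weight s) (weight t) ⟩
      potential z f + weight t - weight s             <⟨ ℤP.+-monoˡ-< (- weight s) (ℤP.+-monoʳ-< (potential z f) (ℤ.+<+ t<s)) ⟩
      potential z f + weight s - weight s             ≡⟨ cancel (potential z f) (weight s) ⟩
      potential z f                                   ∎
      where
      open ℤP.≤-Reasoning
      regroup : ∀ p a b → p - a + b ≡ p + b - a
      regroup = solve-∀
      cancel : ∀ p a → p + a - a ≡ p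
      cancel = solve-∀

  covers-or-descends : ∀ {z f} → B f → z ≤ᵛ f →
                       Covers z f ⊎ ∃[ f′ ] (B f′ × z ≤ᵛ f′ × potential z f′ < potential z f × ⟨ ⊤ , f′ ⟩ ≡ ⟨ ⊤ , f ⟩)
  covers-or-descends {z} {f} fB z≤f with FinP.any? (λ s → (lookup z s ℤP.<? lookup f s) ×-dec improvable? f s)
  ... | no none = inj₁ (record { member = fB ; above = z≤f ; slack-active = λ i zi<fi imp → none (i , zi<fi , imp) })
  ... | yes (s , zs<fs , t , t<s , moved) =
    inj₂ (move f s t , moved , proj₁ step , proj₂ step , ⟨⊤⟩-move f s t)
    where
    step : z ≤ᵛ move f s t × potential z (move f s t) < potential z f
    step = move-down {z} {f} z≤f zs<fs t<s

  covers-exists : ∀ {z f} → B f → z ≤ᵛ f → ∃[ g ] (Covers z g × ⟨ ⊤ , g ⟩ ≡ ⟨ ⊤ , f ⟩)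
  covers-exists {z} {f} fB z≤f =
    descend ℤ.∣ potential z f ∣ fB z≤f (ℤP.≤-reflexive (sym (ℤP.0≤i⇒+∣i∣≡i (potential-nonneg {z} {f} z≤f))))
    where
    descend : ∀ fuel {f} → B f → z ≤ᵛ f → potential z f ≤ + fuel → ∃[ g ] (Covers z g × ⟨ ⊤ , g ⟩ ≡ ⟨ ⊤ , f ⟩)
    descend fuel {f} fB z≤f bound with covers-or-descends {z} {f} fB z≤f
    ... | inj₁ cz = f , cz , refl
    descend zero {f} fB z≤f bound | inj₂ (f′ , _ , z≤f′ , smaller , _) =
      contradiction (ℤP.<-≤-trans smaller bound) (ℤP.≤⇒≯ (potential-nonneg {z} {f′} z≤f′))
    descend (suc fuel) {f} fB z≤f bound | inj₂ (f′ , f′B , z≤f′ , smaller , sum≡) with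
      descend fuel f′B z≤f′ (ℤP.i<j⇒i≤pred[j] (ℤP.<-≤-trans smaller bound))
    ... | g , cg , sum≡′ = g , cg , trans sum≡′ sum≡

  active? : ∀ f → Decidable (Active f)
  active? f s = ¬? (improvable? f s)

  activeSet : Vec ℤ (suc m) → Subset (suc m)
  activeSet f = tabulate (λ s → does (active? f s))

  ∈activeSet⁻ : ∀ {f s} → s ∈ activeSet f → Active f s
  ∈activeSet⁻ {f} {s} s∈ = decidable-stable (active? f s) (λ ¬act → false≢true (trans (sym (dec-false (active? f s) ¬act)) does≡true))
    where
    false≢true : false ≢ true
    false≢true ()
    does≡true : does (active? f s) ≡ true
    does≡true = trans (sym (VecP.lookup∘tabulate (λ s → does (active? f s)) s)) (VecP.[]=⇒lookup s∈)

  ∈activeSet⁺ : ∀ {f s} → Active f s → s ∈ activeSet f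
  ∈activeSet⁺ {f} {s} act =
    VecP.lookup⇒[]= s (activeSet f) (trans (VecP.lookup∘tabulate (λ s → does (active? f s)) s) (dec-true (active? f s) act))

  first-active : ∀ f → ∃[ s ] (s ∈ activeSet f)
  first-active f with least o {λ _ → Unit} (λ _ → yes tt) {zero} tt
  ... | s , _ , nothing-below = s , ∈activeSet⁺ (λ (t , t<s , _) → nothing-below t t<s tt)

  inactive-card : ∀ f → Card (λ s → ¬ Active f s) ∣ ∁ (activeSet f) ∣
  inactive-card f = Card-⇔ (λ s s∈∁A act → x∈∁p⇒x∉p s∈∁A (∈activeSet⁺ act))
                           (λ s ¬act → x∉p⇒x∈∁p (λ s∈A → ¬act (∈activeSet⁻ s∈A)))
                           (members-card (∁ (activeSet f)))

  active-count : ∀ f {j} → Card (λ s → ¬ Active f s) j → j ℕ.≤ m × ∣ activeSet f ∣ ≡ suc (m ∸ j)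
  active-count f {j} inactive with ∣ activeSet f ∣ in ∣A∣≡ | ℕP.≤-<-trans z≤n (x∈p⇒∣p-x∣<∣p∣ (proj₂ (first-active f)))
  ... | suc a | _ = subst (ℕ._≤ m) (sym j≡m∸a) (ℕP.m∸n≤m m a) , cong suc (sym (trans (cong (m ∸_) j≡m∸a) (ℕP.m∸[m∸n]≡n a≤m)))
    where
    a≤m : a ℕ.≤ m
    a≤m = ℕP.≤-pred (subst (ℕ._≤ suc m) ∣A∣≡ (∣p∣≤n (activeSet f)))
    j≡m∸a : j ≡ m ∸ a
    j≡m∸a = trans (card-unique inactive (inactive-card f)) (trans (∣∁p∣≡n∸∣p∣ (activeSet f)) (cong (suc m ∸_) ∣A∣≡))

  Depth : ℕ → Vec ℤ (suc m) → Vec ℤ (suc m) → Set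
  Depth k z f = ⟨ ⊤ , f ⟩ ≡ ⟨ ⊤ , z ⟩ + + k

  lower : Vec ℤ (suc m) → Vec ℕ (suc m) → Vec ℤ (suc m)
  lower f d = f ⊖ Vec.map +_ d

  lookup-lower : ∀ f d i → lookup (lower f d) i ≡ lookup f i - + lookup d i
  lookup-lower f d i = trans (lookup-⊖ f (Vec.map +_ d) i) (cong (λ x → lookup f i - x) (VecP.lookup-map i +_ d))

  lower-injective : ∀ f {d d′} → lower f d ≡ lower f d′ → d ≡ d′
  lower-injective f {d} {d′} eq = vec-ext (λ i → ℤP.+-injective (begin
    + lookup d i                              ≡⟨ restore (lookup f i) (+ lookup d i) ⟩
    lookup f i - (lookup f i - + lookup d i)  ≡⟨ cong (λ x → lookup f i - x) (sym (lookup-lower f d i)) ⟩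
    lookup f i - lookup (lower f d) i         ≡⟨ cong (λ v → lookup f i - lookup v i) eq ⟩
    lookup f i - lookup (lower f d′) i        ≡⟨ cong (λ x → lookup f i - x) (lookup-lower f d′ i) ⟩
    lookup f i - (lookup f i - + lookup d′ i) ≡⟨ sym (restore (lookup f i) (+ lookup d′ i)) ⟩
    + lookup d′ i                             ∎))
    where
    open ≡-Reasoning
    restore : ∀ a b → b ≡ a - (a - b)
    restore = solve-∀

  lower-covered : ∀ {f k d} → B f → IsComposition (activeSet f) k d → Covers (lower f d) f × Depth k (lower f d) f
  lower-covered {f} {k} {d} fB (off , sum≡) = record { member = fB ; above = below-f ; slack-active = slack-active′ } , depth
    where
    below-f : lower f d ≤ᵛ f
    below-f i rewrite lookup-lower f d i = ℤP.i-j≤i (lookup f i) (+ lookup d i)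
    slack-active′ : ∀ i → lookup (lower f d) i < lookup f i → Active f i
    slack-active′ i lowered = decidable-stable (active? f i) (λ inactive → ℤP.<⇒≢ lowered (begin
      lookup (lower f d) i   ≡⟨ lookup-lower f d i ⟩
      lookup f i - + lookup d i ≡⟨ cong (λ x → lookup f i - + x) (off i (λ i∈A → inactive (∈activeSet⁻ i∈A))) ⟩
      lookup f i - 0ℤ        ≡⟨ ℤP.+-identityʳ (lookup f i) ⟩
      lookup f i             ∎))
      where open ≡-Reasoning
    depth : Depth k (lower f d) f
    depth = begin
      ⟨ ⊤ , f ⟩                                                ≡⟨ restore ⟨ ⊤ , f ⟩ ⟨ ⊤ , Vec.map +_ d ⟩ ⟩
      ⟨ ⊤ , f ⟩ - ⟨ ⊤ , Vec.map +_ d ⟩ + ⟨ ⊤ , Vec.map +_ d ⟩ ≡⟨ cong₂ _+_ (sym (⟨⟩-⊖ ⊤ f (Vec.map +_ d))) (trans (⟨⊤⟩-map+ d) (cong +_ sum≡)) ⟩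
      ⟨ ⊤ , lower f d ⟩ + + k                                  ∎
      where
      open ≡-Reasoning
      restore : ∀ a b → a ≡ a - b + b
      restore = solve-∀

  slack : Vec ℤ (suc m) → Vec ℤ (suc m) → Vec ℕ (suc m)
  slack f z = tabulate (λ i → ℤ.∣ lookup f i - lookup z i ∣)

  module _ {z f} (cz : Covers z f) where

    +slack : ∀ i → + lookup (slack f z) i ≡ lookup f i - lookup z i
    +slack i = trans (cong +_ (VecP.lookup∘tabulate (λ i → ℤ.∣ lookup f i - lookup z i ∣) i))
                     (ℤP.0≤i⇒+∣i∣≡i (ℤP.i≤j⇒0≤j-i (Covers.above cz i)))

    lower-slack : lower f (slack f z) ≡ z
    lower-slack = vec-ext (λ i → trans (lookup-lower f (slack f z) i)
                                       (trans (cong (λ x → lookup f i - x) (+slack i)) (restore (lookup f i) (lookup z i))))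
      where
      restore : ∀ a b → a - (a - b) ≡ b
      restore = solve-∀

    slack-composition : ∀ {k} → Depth k z f → IsComposition (activeSet f) k (slack f z)
    slack-composition {k} depth = off , ℤP.+-injective (begin
      + Vec.sum (slack f z)                ≡⟨ sym (⟨⊤⟩-map+ (slack f z)) ⟩
      ⟨ ⊤ , Vec.map +_ (slack f z) ⟩       ≡⟨ cong ⟨ ⊤ ,_⟩ (vec-ext {f = Vec.map +_ (slack f z)} {f ⊖ z}
                                                  (λ i → trans (VecP.lookup-map i +_ (slack f z)) (trans (+slack i) (sym (lookup-⊖ f z i))))) ⟩
      ⟨ ⊤ , f ⊖ z ⟩                        ≡⟨ trans (⟨⟩-⊖ ⊤ f z) (cong (_- ⟨ ⊤ , z ⟩) depth) ⟩
      ⟨ ⊤ , z ⟩ + + k - ⟨ ⊤ , z ⟩          ≡⟨ cancel ⟨ ⊤ , z ⟩ (+ k) ⟩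
      + k                                  ∎)
      where
      open ≡-Reasoning
      cancel : ∀ a b → a + b - a ≡ b
      cancel = solve-∀
      off : ∀ i → i ∉ activeSet f → lookup (slack f z) i ≡ 0
      off i i∉A = ℤP.+-injective (trans (+slack i) (trans (cong (λ x → lookup f i - x) zi≡fi) (ℤP.+-inverseʳ (lookup f i))))
        where
        zi≡fi : lookup z i ≡ lookup f i
        zi≡fi = ℤP.≤-antisym (Covers.above cz i) (ℤP.≮⇒≥ (λ zi<fi → i∉A (∈activeSet⁺ (Covers.slack-active cz i zi<fi))))

  covered-card : ∀ {f} → B f → (k : ℕ) → Card (λ z → Covers z f × Depth k z f) (compositionCount ∣ activeSet f ∣ k)
  covered-card {f} fB k =
    Card-⇔ (λ { _ (d , comp , refl) → lower-covered fB comp })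
           (λ z (cz , depth) → slack f z , slack-composition cz depth , lower-slack cz)
           (Card-image (lower f) (lower-injective f) (compositions-card (activeSet f) k))

  Below : ℕ → Vec ℤ (suc m) → Set
  Below k z = ∃[ f ] (B f × z ≤ᵛ f × Depth k z f)

  count-below : (c : ℕ → ℕ) → (∀ j → Card (λ f → B f × Card (λ s → ¬ Active f s) j) (c j)) →
                (k : ℕ) → Card (Below k) (ehrhartSum m c k)
  count-below c bases k = Card-⇔ level⇒below below⇒level
    (Card-⋃ (List.upTo (suc m)) (Unique.upTo⁺ (suc m)) (λ {j} _ → level-card j) level-disjoint)
    where
    Bases : ℕ → List (Vec ℤ (suc m))
    Bases j = proj₁ (bases j)
    base-facts : ∀ {j f} → f L.∈ Bases j → B f × Card (λ s → ¬ Active f s) j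
    base-facts {j} {f} f∈ = proj₁ (proj₁ (proj₂ (proj₂ (bases j))) f) f∈
    listed : ∀ {j f} → B f × Card (λ s → ¬ Active f s) j → f L.∈ Bases j
    listed {j} {f} facts = proj₂ (proj₁ (proj₂ (proj₂ (bases j))) f) facts
    Level : ℕ → Vec ℤ (suc m) → Set
    Level j z = ∃[ f ] (f L.∈ Bases j × Covers z f × Depth k z f)
    level-card : ∀ j → Card (Level j) (c j ℕ.* ((k ℕ.+ (m ∸ j)) C (m ∸ j)))
    level-card j = subst (Card (Level j)) (trans (sum-map-const _ (Bases j)) (cong (ℕ._* _) (proj₂ (proj₂ (proj₂ (bases j))))))
      (Card-⋃ (Bases j) (proj₁ (proj₂ (bases j))) covered (λ _ _ (cz , _) (cz′ , _) → covers-unique cz cz′))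
      where
      covered : ∀ {f} → f L.∈ Bases j → Card (λ z → Covers z f × Depth k z f) ((k ℕ.+ (m ∸ j)) C (m ∸ j))
      covered f∈ with base-facts f∈
      ... | fB , inactive = subst (Card _) (trans (cong (λ a → compositionCount a k) (proj₂ (active-count _ inactive)))
                                                  (compositionCount-C (m ∸ j) k))
                                  (covered-card fB k)
    level-disjoint : ∀ {j j′ z} → j L.∈ List.upTo (suc m) → j′ L.∈ List.upTo (suc m) → Level j z → Level j′ z → j ≡ j′
    level-disjoint _ _ (f , f∈ , cz , _) (f′ , f′∈ , cz′ , _) with covers-unique cz cz′
    ... | refl = card-unique (proj₂ (base-facts f∈)) (proj₂ (base-facts f′∈))
    level⇒below : ∀ z → ∃[ j ] (j L.∈ List.upTo (suc m) × Level j z) → Below k z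
    level⇒below z (_ , _ , f , f∈ , cz , depth) = f , Covers.member cz , Covers.above cz , depth
    below⇒level : ∀ z → Below k z → ∃[ j ] (j L.∈ List.upTo (suc m) × Level j z)
    below⇒level z (f , fB , z≤f , depth) =
      let g , cz , sum≡ = covers-exists fB z≤f in
      ∣ ∁ (activeSet g) ∣ , ∈-upTo⁺ (s≤s (proj₁ (active-count g (inactive-card g))))
      , g , listed (Covers.member cz , inactive-card g) , cz , trans sum≡ depth

-- Rational points

private
  toℚᵘ-toℚ : ∀ a → toℚᵘ (toℚ a) ℚᵘ.≃ ℚᵘ.mkℚᵘ a 0
  toℚᵘ-toℚ a = ℚP.toℚᵘ-fromℚᵘ (ℚᵘ.mkℚᵘ a 0)

  via-ℚᵘ : ∀ {p} a → toℚᵘ p ℚᵘ.≃ ℚᵘ.mkℚᵘ a 0 → p ≡ toℚ a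
  via-ℚᵘ {p} a eq = trans (sym (ℚP.fromℚᵘ-toℚᵘ p)) (ℚP.fromℚᵘ-cong eq)

toℚ-+ : ∀ a b → toℚ (a + b) ≡ toℚ a ℚ.+ toℚ b
toℚ-+ a b = sym (via-ℚᵘ (a + b) (ℚᵘP.≃-trans (ℚP.toℚᵘ-homo-+ (toℚ a) (toℚ b))
  (ℚᵘP.≃-trans (ℚᵘP.+-cong (toℚᵘ-toℚ a) (toℚᵘ-toℚ b)) (ℚᵘ.*≡* (normalise a b)))))
  where
  normalise : ∀ a b → (a * + 1 + b * + 1) * + 1 ≡ (a + b) * + 1
  normalise = solve-∀

toℚ-neg : ∀ a → toℚ (- a) ≡ ℚ.- toℚ a
toℚ-neg a = sym (via-ℚᵘ (- a) (ℚᵘP.≃-trans (ℚP.toℚᵘ-homo‿- (toℚ a)) (ℚᵘP.-‿cong (toℚᵘ-toℚ a))))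

toℚ-mono-≤ : ∀ {a b} → a ≤ b → toℚ a ℚ.≤ toℚ b
toℚ-mono-≤ {a} {b} a≤b = ℚP.toℚᵘ-cancel-≤ (ℚᵘP.≤-respˡ-≃ (ℚᵘP.≃-sym (toℚᵘ-toℚ a)) (ℚᵘP.≤-respʳ-≃ (ℚᵘP.≃-sym (toℚᵘ-toℚ b))
  (ℚᵘ.*≤* (subst₂ _≤_ (sym (ℤP.*-identityʳ a)) (sym (ℤP.*-identityʳ b)) a≤b))))

toℚ-cancel-≤ : ∀ {a b} → toℚ a ℚ.≤ toℚ b → a ≤ b
toℚ-cancel-≤ {a} {b} a≤b with ℚᵘP.≤-respˡ-≃ (toℚᵘ-toℚ a) (ℚᵘP.≤-respʳ-≃ (toℚᵘ-toℚ b) (ℚP.toℚᵘ-mono-≤ a≤b))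
... | ℚᵘ.*≤* a*1≤b*1 = subst₂ _≤_ (ℤP.*-identityʳ a) (ℤP.*-identityʳ b) a*1≤b*1

toℚ-injective : ∀ {a b} → toℚ a ≡ toℚ b → a ≡ b
toℚ-injective eq = ℤP.≤-antisym (toℚ-cancel-≤ (ℚP.≤-reflexive eq)) (toℚ-cancel-≤ (ℚP.≤-reflexive (sym eq)))

toℚ-- : ∀ a b → toℚ (a - b) ≡ toℚ a ℚ.- toℚ b
toℚ-- a b = trans (toℚ-+ a (- b)) (cong (toℚ a ℚ.+_) (toℚ-neg b))

sumℚ-cong : {f g : Fin n → ℚ} → (∀ i → f i ≡ g i) → sumℚ f ≡ sumℚ g
sumℚ-cong {zero} f≡g = refl
sumℚ-cong {suc n} f≡g = cong₂ ℚ._+_ (f≡g zero) (sumℚ-cong (λ i → f≡g (suc i)))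

sumℚ-+ : (f g : Fin n → ℚ) → sumℚ (λ i → f i ℚ.+ g i) ≡ sumℚ f ℚ.+ sumℚ g
sumℚ-+ {zero} f g = sym (ℚP.+-identityˡ 0ℚ)
sumℚ-+ {suc n} f g = trans (cong (f zero ℚ.+ g zero ℚ.+_) (sumℚ-+ (λ i → f (suc i)) (λ i → g (suc i))))
  (interchange (f zero) (g zero) (sumℚ (λ i → f (suc i))) (sumℚ (λ i → g (suc i))))
  where
  interchange : ∀ a b c d → a ℚ.+ b ℚ.+ (c ℚ.+ d) ≡ a ℚ.+ c ℚ.+ (b ℚ.+ d)
  interchange = solveℚ 4 (λ a b c d → a :+ b :+ (c :+ d) := a :+ c :+ (b :+ d)) refl

sumℚ-*ˡ : ∀ c (f : Fin n → ℚ) → sumℚ (λ i → c ℚ.* f i) ≡ c ℚ.* sumℚ f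
sumℚ-*ˡ {zero} c f = sym (ℚP.*-zeroʳ c)
sumℚ-*ˡ {suc n} c f = trans (cong (c ℚ.* f zero ℚ.+_) (sumℚ-*ˡ c (λ i → f (suc i)))) (sym (ℚP.*-distribˡ-+ c (f zero) _))

sumℚ-neg : (f : Fin n → ℚ) → sumℚ (λ i → ℚ.- f i) ≡ ℚ.- sumℚ f
sumℚ-neg {zero} f = refl
sumℚ-neg {suc n} f = trans (cong (ℚ.- f zero ℚ.+_) (sumℚ-neg (λ i → f (suc i)))) (sym (ℚP.neg-distrib-+ (f zero) _))

sumℚ-toℚ : (f : Vec ℤ n) → sumℚ (vecℚ f) ≡ toℚ ⟨ ⊤ , f ⟩
sumℚ-toℚ [] = refl
sumℚ-toℚ (x ∷ f) = trans (cong (toℚ x ℚ.+_) (sumℚ-toℚ f)) (sym (toℚ-+ x ⟨ ⊤ , f ⟩))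

toℚ-suc*inverse : ∀ k → toℚ (+ suc k) ℚ.* mkℚ (+ 1) k (1-coprimeTo (suc k)) ≡ 1ℚ
toℚ-suc*inverse k = ℚP.toℚᵘ-injective (ℚᵘP.≃-trans (ℚP.toℚᵘ-homo-* (toℚ (+ suc k)) (mkℚ (+ 1) k (1-coprimeTo (suc k))))
  (ℚᵘP.≃-trans (ℚᵘP.*-congʳ (toℚᵘ-toℚ (+ suc k))) (ℚᵘ.*≡* cross)))
  where
  unit : ∀ a → a * + 1 * + 1 ≡ + 1 * a
  unit = solve-∀
  cross : (+ suc k * + 1) * + 1 ≡ + 1 * + suc (k ℕ.+ 0)
  cross = trans (unit (+ suc k)) (cong (λ x → + 1 * + suc x) (sym (ℕP.+-identityʳ k)))

dot-vecℚ : (U : Subset n) (f : Vec ℤ n) → dot U (vecℚ f) ≡ toℚ ⟨ U , f ⟩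
dot-vecℚ [] [] = refl
dot-vecℚ (inside ∷ U) (x ∷ f) = trans (cong (toℚ x ℚ.+_) (dot-vecℚ U f)) (sym (toℚ-+ x ⟨ U , f ⟩))
dot-vecℚ (outside ∷ U) (x ∷ f) = trans (cong (0ℚ ℚ.+_) (dot-vecℚ U f)) (sym (toℚ-+ 0ℤ ⟨ U , f ⟩))

dot-mono-≤ : (U : Subset n) {a b : Fin n → ℚ} → (∀ i → a i ℚ.≤ b i) → dot U a ℚ.≤ dot U b
dot-mono-≤ [] a≤b = ℚP.≤-refl
dot-mono-≤ (inside ∷ U) a≤b = ℚP.+-mono-≤ (a≤b zero) (dot-mono-≤ U (λ i → a≤b (suc i)))
dot-mono-≤ (outside ∷ U) a≤b = ℚP.+-mono-≤ (ℚP.≤-refl {0ℚ}) (dot-mono-≤ U (λ i → a≤b (suc i)))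

dot-⊤ : (x : Fin n → ℚ) → dot ⊤ x ≡ sumℚ x
dot-⊤ {zero} x = refl
dot-⊤ {suc n} x = cong (x zero ℚ.+_) (dot-⊤ (λ i → x (suc i)))

dot-⊥ : (x : Fin n → ℚ) → dot ⊥ x ≡ 0ℚ
dot-⊥ {zero} x = refl
dot-⊥ {suc n} x = trans (cong (0ℚ ℚ.+_) (dot-⊥ (λ i → x (suc i)))) (ℚP.+-identityˡ 0ℚ)

dot-∁ : (T : Subset n) (x : Fin n → ℚ) → dot T x ℚ.+ dot (∁ T) x ≡ dot ⊤ x
dot-∁ [] x = refl
dot-∁ (inside ∷ T) x = trans (regroup (x zero) (dot T (λ i → x (suc i))) (dot (∁ T) (λ i → x (suc i))))
                             (cong (x zero ℚ.+_) (dot-∁ T (λ i → x (suc i))))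
  where
  regroup : ∀ a b c → a ℚ.+ b ℚ.+ (0ℚ ℚ.+ c) ≡ a ℚ.+ (b ℚ.+ c)
  regroup = solveℚ 3 (λ a b c → a :+ b :+ (con 0ℚ :+ c) := a :+ (b :+ c)) refl
dot-∁ (outside ∷ T) x = trans (regroup (x zero) (dot T (λ i → x (suc i))) (dot (∁ T) (λ i → x (suc i))))
                              (cong (x zero ℚ.+_) (dot-∁ T (λ i → x (suc i))))
  where
  regroup : ∀ a b c → 0ℚ ℚ.+ b ℚ.+ (a ℚ.+ c) ≡ a ℚ.+ (b ℚ.+ c)
  regroup = solveℚ 3 (λ a b c → con 0ℚ :+ b :+ (a :+ c) := a :+ (b :+ c)) refl

dot-⁅⁆ : (i : Fin n) (x : Fin n → ℚ) → dot ⁅ i ⁆ x ≡ x i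
dot-⁅⁆ {suc n} zero x = trans (cong (x zero ℚ.+_) (dot-⊥ (λ i → x (suc i)))) (ℚP.+-identityʳ (x zero))
dot-⁅⁆ {suc n} (suc i) x = trans (cong (0ℚ ℚ.+_) (dot-⁅⁆ i (λ j → x (suc j)))) (ℚP.+-identityˡ _)

module Bases (μ : Subset n → ℤ) where
  open Polymatroid μ

  isBase⇒baseℤ : ∀ {f} → IsBase μ f → Baseℤ f
  isBase⇒baseℤ {f} ((nonneg , bounded) , total) =
    baseℤ (inPℤ (λ i → toℚ-cancel-≤ (nonneg i)) (λ U → toℚ-cancel-≤ (subst (ℚ._≤ toℚ (μ U)) (dot-vecℚ U f) (bounded U))))
          (toℚ-injective (trans (sym (dot-vecℚ ⊤ f)) total))

  baseℤ⇒isBase : ∀ {f} → Baseℤ f → IsBase μ f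
  baseℤ⇒isBase {f} (baseℤ (inPℤ nonneg bounded) total) =
    ((λ i → toℚ-mono-≤ (nonneg i)) , (λ U → subst (ℚ._≤ toℚ (μ U)) (sym (dot-vecℚ U f)) (toℚ-mono-≤ (bounded U)))) ,
    trans (dot-vecℚ ⊤ f) (cong toℚ total)

  module _ (sub : Submodular μ) where
    open Exchange sub

    integral-base-between : ∀ {x} → InB μ x → ∀ {y Z} → (∀ i → 0ℤ ≤ lookup y i) →
                            (∀ i → vecℚ y i ℚ.≤ x i) → (∀ i → x i ℚ.≤ vecℚ Z i) → ∃[ f ] (Baseℤ f × y ≤ᵛ f × f ≤ᵛ Z)
    integral-base-between {x} ((x≥0 , x≤μ) , x-total) {y} {Z} y≥0 y≤x x≤Z = augment {y} (inPℤ y≥0 y-bounded) y≤Z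
      where
      y-bounded : ∀ U → ⟨ U , y ⟩ ≤ μ U
      y-bounded U = toℚ-cancel-≤ (subst (ℚ._≤ toℚ (μ U)) (dot-vecℚ U y) (ℚP.≤-trans (dot-mono-≤ U y≤x) (x≤μ U)))
      y≤Z : y ≤ᵛ Z
      y≤Z i = toℚ-cancel-≤ (ℚP.≤-trans (y≤x i) (x≤Z i))
      cut : ∀ T → μ ⊤ ≤ μ T + ⟨ ∁ T , Z ⟩
      cut T = toℚ-cancel-≤ (begin
        toℚ (μ ⊤)                           ≡⟨ sym x-total ⟩
        dot ⊤ x                             ≡⟨ sym (dot-∁ T x) ⟩
        dot T x ℚ.+ dot (∁ T) x             ≤⟨ ℚP.+-mono-≤ (x≤μ T) (dot-mono-≤ (∁ T) x≤Z) ⟩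
        toℚ (μ T) ℚ.+ dot (∁ T) (vecℚ Z)    ≡⟨ cong (toℚ (μ T) ℚ.+_) (dot-vecℚ (∁ T) Z) ⟩
        toℚ (μ T) ℚ.+ toℚ ⟨ ∁ T , Z ⟩       ≡⟨ sym (toℚ-+ (μ T) ⟨ ∁ T , Z ⟩) ⟩
        toℚ (μ T + ⟨ ∁ T , Z ⟩)             ∎)
        where open ℚP.≤-Reasoning
      whole : μ ⊤ ≤ ⟨ ⊤ , Z ⟩
      whole = toℚ-cancel-≤ (subst₂ ℚ._≤_ x-total (dot-vecℚ ⊤ Z) (dot-mono-≤ ⊤ x≤Z))
      open Augmentation Z cut whole

-- Lattice points of B_μ + k∇ and B_μ + kΔ

ConvexWeights : (Fin n → ℚ) → Set
ConvexWeights λ′ = (∀ s → 0ℚ ℚ.≤ λ′ s) × sumℚ λ′ ≡ 1ℚ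

convex-weights : ∀ {m} (k : ℕ) (d : Vec ℤ (suc m)) → (∀ i → 0ℤ ≤ lookup d i) → ⟨ ⊤ , d ⟩ ≡ + k →
                 Σ[ λ′ ∈ (Fin (suc m) → ℚ) ] (ConvexWeights λ′ × ∀ i → toℚ (+ k) ℚ.* λ′ i ≡ vecℚ d i)
convex-weights {m} zero d d≥0 sum≡0 = λ′ , (λ′≥0 , sum≡1) , λ i → trans (ℚP.*-zeroˡ (λ′ i)) (cong toℚ (sym (nonneg-sum-zero d d≥0 sum≡0 i)))
  where
  λ′ : Fin (suc m) → ℚ
  λ′ zero = 1ℚ
  λ′ (suc _) = 0ℚ
  λ′≥0 : ∀ s → 0ℚ ℚ.≤ λ′ s
  λ′≥0 zero = ℚP.nonNegative⁻¹ 1ℚ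
  λ′≥0 (suc s) = ℚP.≤-refl
  sum≡1 : sumℚ λ′ ≡ 1ℚ
  sum≡1 = trans (cong (1ℚ ℚ.+_) (sumℚ-zero m)) (ℚP.+-identityʳ 1ℚ)
    where
    sumℚ-zero : ∀ n → sumℚ {n} (λ _ → 0ℚ) ≡ 0ℚ
    sumℚ-zero zero = refl
    sumℚ-zero (suc n) = trans (ℚP.+-identityˡ _) (sumℚ-zero n)
convex-weights {m} (suc k) d d≥0 sum≡k = λ′ , (λ′≥0 , sum≡1) , scaled
  where
  K K⁻¹ : ℚ
  K = toℚ (+ suc k)
  K⁻¹ = mkℚ (+ 1) k (1-coprimeTo (suc k))
  λ′ : Fin (suc m) → ℚ
  λ′ i = K⁻¹ ℚ.* vecℚ d i
  λ′≥0 : ∀ s → 0ℚ ℚ.≤ λ′ s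
  λ′≥0 s = subst (ℚ._≤ λ′ s) (ℚP.*-zeroʳ K⁻¹) (ℚP.*-monoˡ-≤-nonNeg K⁻¹ (toℚ-mono-≤ (d≥0 s)))
  sum≡1 : sumℚ λ′ ≡ 1ℚ
  sum≡1 = trans (sumℚ-*ˡ K⁻¹ (vecℚ d)) (trans (cong (K⁻¹ ℚ.*_) (trans (sumℚ-toℚ d) (cong toℚ sum≡k)))
                (trans (ℚP.*-comm K⁻¹ K) (toℚ-suc*inverse k)))
  scaled : ∀ i → K ℚ.* λ′ i ≡ vecℚ d i
  scaled i = trans (sym (ℚP.*-assoc K K⁻¹ (vecℚ d i))) (trans (cong (ℚ._* vecℚ d i) (toℚ-suc*inverse k)) (ℚP.*-identityˡ (vecℚ d i)))

module Minkowski {m : ℕ} (μ : Subset (suc m) → ℤ) (sub : Submodular μ) where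
  open Polymatroid μ
  open Bases μ

  private
    K : ℕ → ℚ
    K k = toℚ (+ k)

    K≥0 : ∀ k → 0ℚ ℚ.≤ K k
    K≥0 k = toℚ-mono-≤ {0ℤ} {+ k} (ℤ.+≤+ ℕ.z≤n)

  ⟨⊤⟩-of-sum : ∀ {x y} k (z : Vec ℤ (suc m)) → InB μ x → (∀ i → vecℚ z i ≡ x i ℚ.+ K k ℚ.* y i) →
               toℚ ⟨ ⊤ , z ⟩ ≡ toℚ (μ ⊤) ℚ.+ K k ℚ.* sumℚ y
  ⟨⊤⟩-of-sum {x} {y} k z (_ , x-total) z≡ = begin
    toℚ ⟨ ⊤ , z ⟩                         ≡⟨ sym (sumℚ-toℚ z) ⟩
    sumℚ (vecℚ z)                         ≡⟨ sumℚ-cong z≡ ⟩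
    sumℚ (λ i → x i ℚ.+ K k ℚ.* y i)      ≡⟨ sumℚ-+ x (λ i → K k ℚ.* y i) ⟩
    sumℚ x ℚ.+ sumℚ (λ i → K k ℚ.* y i)   ≡⟨ cong₂ ℚ._+_ (trans (sym (dot-⊤ x)) x-total) (sumℚ-*ˡ (K k) y) ⟩
    toℚ (μ ⊤) ℚ.+ K k ℚ.* sumℚ y          ∎
    where open ≡-Reasoning

  module _ (k : ℕ) (z : Vec ℤ (suc m)) where

    nabla⇒below : InMinkowski μ k InNabla z → ∃[ f ] (IsBase μ f × z ≤ᵛ f × ⟨ ⊤ , f ⟩ ≡ ⟨ ⊤ , z ⟩ + + k)
    nabla⇒below (x , y , xB , (λ′ , λ′≥0 , sum≡1 , y≡) , z≡) = finish (integral-base-between sub xB {z⁺} {Z} z⁺≥0 z⁺≤x x≤Z)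
      where
      z≤x : ∀ i → vecℚ z i ℚ.≤ x i
      z≤x i = begin
        vecℚ z i                     ≡⟨ trans (z≡ i) (cong (λ w → x i ℚ.+ K k ℚ.* w) (y≡ i)) ⟩
        x i ℚ.+ K k ℚ.* ℚ.- λ′ i     ≡⟨ cong (x i ℚ.+_) (sym (ℚP.neg-distribʳ-* (K k) (λ′ i))) ⟩
        x i ℚ.- K k ℚ.* λ′ i         ≤⟨ ℚP.+-monoʳ-≤ (x i) (ℚP.neg-antimono-≤ (ℚP.*-monoˡ-≤-nonNeg (K k) {{ℚ.nonNegative (K≥0 k)}} (λ′≥0 i))) ⟩
        x i ℚ.- K k ℚ.* 0ℚ           ≡⟨ cong (λ w → x i ℚ.- w) (ℚP.*-zeroʳ (K k)) ⟩
        x i ℚ.- 0ℚ                   ≡⟨ ℚP.+-identityʳ (x i) ⟩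
        x i                          ∎
        where open ℚP.≤-Reasoning
      z⁺ Z : Vec ℤ (suc m)
      z⁺ = Vec.map (ℤ._⊔ 0ℤ) z
      Z = tabulate (λ i → μ ⁅ i ⁆)
      z⁺≥0 : ∀ i → 0ℤ ≤ lookup z⁺ i
      z⁺≥0 i = subst (0ℤ ≤_) (sym (VecP.lookup-map i (ℤ._⊔ 0ℤ) z)) (ℤP.i≤j⊔i (lookup z i) 0ℤ)
      z⁺≤x : ∀ i → vecℚ z⁺ i ℚ.≤ x i
      z⁺≤x i rewrite VecP.lookup-map i (ℤ._⊔ 0ℤ) z with ℤP.⊔-sel (lookup z i) 0ℤ
      ... | inj₁ ⊔≡z rewrite ⊔≡z = z≤x i
      ... | inj₂ ⊔≡0 rewrite ⊔≡0 = proj₁ (proj₁ xB) i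
      x≤Z : ∀ i → x i ℚ.≤ vecℚ Z i
      x≤Z i = subst₂ ℚ._≤_ (dot-⁅⁆ i x) (cong toℚ (sym (VecP.lookup∘tabulate (λ i → μ ⁅ i ⁆) i))) (proj₂ (proj₁ xB) ⁅ i ⁆)
      total-z : ⟨ ⊤ , z ⟩ ≡ μ ⊤ - + k
      total-z = toℚ-injective (begin
        toℚ ⟨ ⊤ , z ⟩                      ≡⟨ ⟨⊤⟩-of-sum k z xB z≡ ⟩
        toℚ (μ ⊤) ℚ.+ K k ℚ.* sumℚ y       ≡⟨ cong (λ w → toℚ (μ ⊤) ℚ.+ K k ℚ.* w) (trans (sumℚ-cong y≡) (trans (sumℚ-neg λ′) (cong ℚ.-_ sum≡1))) ⟩
        toℚ (μ ⊤) ℚ.+ K k ℚ.* ℚ.- 1ℚ       ≡⟨ cong (toℚ (μ ⊤) ℚ.+_) (trans (sym (ℚP.neg-distribʳ-* (K k) 1ℚ)) (cong ℚ.-_ (ℚP.*-identityʳ (K k)))) ⟩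
        toℚ (μ ⊤) ℚ.- K k                  ≡⟨ sym (toℚ-- (μ ⊤) (+ k)) ⟩
        toℚ (μ ⊤ - + k)                    ∎)
        where open ≡-Reasoning
      finish : ∃[ f ] (Baseℤ f × z⁺ ≤ᵛ f × f ≤ᵛ Z) → ∃[ f ] (IsBase μ f × z ≤ᵛ f × ⟨ ⊤ , f ⟩ ≡ ⟨ ⊤ , z ⟩ + + k)
      finish (f , fB , z⁺≤f , _) = f , baseℤ⇒isBase fB , z≤f , depth
        where
        z≤f : z ≤ᵛ f
        z≤f i = ℤP.≤-trans (subst (lookup z i ≤_) (sym (VecP.lookup-map i (ℤ._⊔ 0ℤ) z)) (ℤP.i≤i⊔j (lookup z i) 0ℤ)) (z⁺≤f i)
        depth : ⟨ ⊤ , f ⟩ ≡ ⟨ ⊤ , z ⟩ + + k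
        depth = trans (total fB) (trans (restore (μ ⊤) (+ k)) (cong (_+ + k) (sym total-z)))
          where
          restore : ∀ a b → a ≡ a - b + b
          restore = solve-∀

    below⇒nabla : ∃[ f ] (IsBase μ f × z ≤ᵛ f × ⟨ ⊤ , f ⟩ ≡ ⟨ ⊤ , z ⟩ + + k) → InMinkowski μ k InNabla z
    below⇒nabla (f , fB , z≤f , depth) =
      let λ′ , (λ′≥0 , sum≡1) , scaled = convex-weights k (f ⊖ z) gap≥0 gap-total
      in vecℚ f , (λ i → ℚ.- λ′ i) , fB , (λ′ , λ′≥0 , sum≡1 , λ i → refl) , z≡ {λ′} scaled
      where
      gap≥0 : ∀ i → 0ℤ ≤ lookup (f ⊖ z) i
      gap≥0 i = subst (0ℤ ≤_) (sym (lookup-⊖ f z i)) (ℤP.i≤j⇒0≤j-i (z≤f i))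
      gap-total : ⟨ ⊤ , f ⊖ z ⟩ ≡ + k
      gap-total = trans (⟨⟩-⊖ ⊤ f z) (trans (cong (_- ⟨ ⊤ , z ⟩) depth) (cancel ⟨ ⊤ , z ⟩ (+ k)))
        where
        cancel : ∀ a b → a + b - a ≡ b
        cancel = solve-∀
      z≡ : ∀ {λ′} → (∀ i → K k ℚ.* λ′ i ≡ vecℚ (f ⊖ z) i) → ∀ i → vecℚ z i ≡ vecℚ f i ℚ.+ K k ℚ.* ℚ.- λ′ i
      z≡ {λ′} scaled i = sym (begin
        vecℚ f i ℚ.+ K k ℚ.* ℚ.- λ′ i        ≡⟨ cong (vecℚ f i ℚ.+_) (trans (sym (ℚP.neg-distribʳ-* (K k) (λ′ i))) (cong ℚ.-_ (scaled i))) ⟩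
        vecℚ f i ℚ.- vecℚ (f ⊖ z) i          ≡⟨ sym (toℚ-- (lookup f i) (lookup (f ⊖ z) i)) ⟩
        toℚ (lookup f i - lookup (f ⊖ z) i)  ≡⟨ cong (λ w → toℚ (lookup f i - w)) (lookup-⊖ f z i) ⟩
        toℚ (lookup f i - (lookup f i - lookup z i)) ≡⟨ cong toℚ (restore (lookup f i) (lookup z i)) ⟩
        vecℚ z i                             ∎)
        where
        open ≡-Reasoning
        restore : ∀ a b → a - (a - b) ≡ b
        restore = solve-∀

    delta⇒above : InMinkowski μ k InDelta z → ∃[ f ] (IsBase μ f × f ≤ᵛ z × ⟨ ⊤ , z ⟩ ≡ ⟨ ⊤ , f ⟩ + + k)
    delta⇒above (x , y , xB , (λ′ , λ′≥0 , sum≡1 , y≡) , z≡) = finish (integral-base-between sub xB {zeros} {z} zeros≥0 zeros≤x x≤z)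
      where
      x≤z : ∀ i → x i ℚ.≤ vecℚ z i
      x≤z i = begin
        x i                     ≡⟨ sym (ℚP.+-identityʳ (x i)) ⟩
        x i ℚ.+ 0ℚ              ≤⟨ ℚP.+-monoʳ-≤ (x i) (subst (ℚ._≤ K k ℚ.* λ′ i) (ℚP.*-zeroʳ (K k))
                                     (ℚP.*-monoˡ-≤-nonNeg (K k) {{ℚ.nonNegative (K≥0 k)}} (λ′≥0 i))) ⟩
        x i ℚ.+ K k ℚ.* λ′ i    ≡⟨ sym (trans (z≡ i) (cong (λ w → x i ℚ.+ K k ℚ.* w) (y≡ i))) ⟩
        vecℚ z i                ∎
        where open ℚP.≤-Reasoning
      zeros : Vec ℤ (suc m)
      zeros = Vec.replicate (suc m) 0ℤ
      zeros≥0 : ∀ i → 0ℤ ≤ lookup zeros i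
      zeros≥0 i = ℤP.≤-reflexive (sym (VecP.lookup-replicate i 0ℤ))
      zeros≤x : ∀ i → vecℚ zeros i ℚ.≤ x i
      zeros≤x i rewrite VecP.lookup-replicate i 0ℤ = proj₁ (proj₁ xB) i
      total-z : ⟨ ⊤ , z ⟩ ≡ μ ⊤ + + k
      total-z = toℚ-injective (begin
        toℚ ⟨ ⊤ , z ⟩                  ≡⟨ ⟨⊤⟩-of-sum k z xB z≡ ⟩
        toℚ (μ ⊤) ℚ.+ K k ℚ.* sumℚ y   ≡⟨ cong (λ w → toℚ (μ ⊤) ℚ.+ K k ℚ.* w) (trans (sumℚ-cong y≡) sum≡1) ⟩
        toℚ (μ ⊤) ℚ.+ K k ℚ.* 1ℚ       ≡⟨ cong (toℚ (μ ⊤) ℚ.+_) (ℚP.*-identityʳ (K k)) ⟩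
        toℚ (μ ⊤) ℚ.+ K k              ≡⟨ sym (toℚ-+ (μ ⊤) (+ k)) ⟩
        toℚ (μ ⊤ + + k)                ∎)
        where open ≡-Reasoning
      finish : ∃[ f ] (Baseℤ f × zeros ≤ᵛ f × f ≤ᵛ z) → ∃[ f ] (IsBase μ f × f ≤ᵛ z × ⟨ ⊤ , z ⟩ ≡ ⟨ ⊤ , f ⟩ + + k)
      finish (f , fB , _ , f≤z) = f , baseℤ⇒isBase fB , f≤z , trans total-z (cong (_+ + k) (sym (total fB)))

    above⇒delta : ∃[ f ] (IsBase μ f × f ≤ᵛ z × ⟨ ⊤ , z ⟩ ≡ ⟨ ⊤ , f ⟩ + + k) → InMinkowski μ k InDelta z
    above⇒delta (f , fB , f≤z , depth) =
      let λ′ , weights , scaled = convex-weights k (z ⊖ f) gap≥0 gap-total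
      in vecℚ f , λ′ , fB , (λ′ , proj₁ weights , proj₂ weights , λ i → refl) , z≡ {λ′} scaled
      where
      gap≥0 : ∀ i → 0ℤ ≤ lookup (z ⊖ f) i
      gap≥0 i = subst (0ℤ ≤_) (sym (lookup-⊖ z f i)) (ℤP.i≤j⇒0≤j-i (f≤z i))
      gap-total : ⟨ ⊤ , z ⊖ f ⟩ ≡ + k
      gap-total = trans (⟨⟩-⊖ ⊤ z f) (trans (cong (_- ⟨ ⊤ , f ⟩) depth) (cancel ⟨ ⊤ , f ⟩ (+ k)))
        where
        cancel : ∀ a b → a + b - a ≡ b
        cancel = solve-∀
      z≡ : ∀ {λ′} → (∀ i → K k ℚ.* λ′ i ≡ vecℚ (z ⊖ f) i) → ∀ i → vecℚ z i ≡ vecℚ f i ℚ.+ K k ℚ.* λ′ i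
      z≡ {λ′} scaled i = sym (begin
        vecℚ f i ℚ.+ K k ℚ.* λ′ i             ≡⟨ cong (vecℚ f i ℚ.+_) (scaled i) ⟩
        vecℚ f i ℚ.+ vecℚ (z ⊖ f) i           ≡⟨ sym (toℚ-+ (lookup f i) (lookup (z ⊖ f) i)) ⟩
        toℚ (lookup f i + lookup (z ⊖ f) i)   ≡⟨ cong (λ w → toℚ (lookup f i + w)) (lookup-⊖ z f i) ⟩
        toℚ (lookup f i + (lookup z i - lookup f i)) ≡⟨ cong toℚ (restore (lookup f i) (lookup z i)) ⟩
        vecℚ z i                              ∎)
        where
        open ≡-Reasoning
        restore : ∀ a b → a + (b - a) ≡ b
        restore = solve-∀

module Counts {m : ℕ} (μ : Subset (suc m) → ℤ) (sub : Submodular μ) (o : LinOrd (suc m)) where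
  open Polymatroid μ
  open Exchange sub
  open Bases μ
  open Minkowski μ sub

  isBase? : Decidable (IsBase μ)
  isBase? f = map′ baseℤ⇒isBase isBase⇒baseℤ (baseℤ? f)

  exchange-isBase : Exchange (IsBase μ)
  exchange-isBase f g {s} fB gB gs<fs = conclude (exchangeᴵ {f} {g} {s} (isBase⇒baseℤ fB) (isBase⇒baseℤ gB) gs<fs)
    where
    conclude : ∃[ t ] (lookup f t < lookup g t × Baseℤ (move g t s)) → ∃[ t ] (lookup f t < lookup g t × IsBase μ (move g t s))
    conclude (t , ft<gt , moved) = t , ft<gt , baseℤ⇒isBase moved

  exchange-neg : Exchange (λ f → IsBase μ (neg f))
  exchange-neg f g {s} fB gB gs<fs =
    conclude (exchangeᴱ {neg f} {neg g} {s} (isBase⇒baseℤ fB) (isBase⇒baseℤ gB) (subst₂ _<_ (sym (lookup-neg f s)) (sym (lookup-neg g s)) (ℤP.neg-mono-< gs<fs)))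
    where
    conclude : ∃[ t ] (lookup (neg g) t < lookup (neg f) t × Baseℤ (move (neg g) s t)) →
               ∃[ t ] (lookup f t < lookup g t × IsBase μ (neg (move g t s)))
    conclude (t , gt<ft , moved) = t , ℤP.neg-cancel-< (subst₂ _<_ (lookup-neg g t) (lookup-neg f t) gt<ft)
                                 , subst (IsBase μ) (sym (neg-move g t s)) (baseℤ⇒isBase moved)

  module Interior = LatticePointsBelow o isBase? exchange-isBase
  module Exterior = LatticePointsBelow o (λ f → isBase? (neg f)) exchange-neg

  -- Interior.Active is InternallyActive μ o by definition, so the coefficients are used as given.
  nabla-card : ∀ {c} → InteriorCoeffs μ o c → (k : ℕ) → Card (InMinkowski μ k InNabla) (ehrhartSum m c k)
  nabla-card {c} interior k = Card-⇔ (below⇒nabla k) (nabla⇒below k) (Interior.count-below c interior k)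

  exterior-active : ∀ {f s} → Exterior.Active f s → ExternallyActive μ o (neg f) s
  exterior-active {f} {s} act (t , t<s , moved) = act (t , t<s , subst (IsBase μ) (trans (⊕⊖≡move (neg f) s t) (sym (neg-move f s t))) moved)

  active-exterior : ∀ {f s} → ExternallyActive μ o (neg f) s → Exterior.Active f s
  active-exterior {f} {s} act (t , t<s , moved) = act (t , t<s , subst (IsBase μ) (trans (neg-move f s t) (sym (⊕⊖≡move (neg f) s t))) moved)

  exterior-coeffs : ∀ {c} → ExteriorCoeffs μ o c → ∀ j → Card (λ f → IsBase μ (neg f) × Card (λ s → ¬ Exterior.Active f s) j) (c j)
  exterior-coeffs exterior j = Card-⇔ to from (Card-image neg neg-injective (exterior j))
    where
    to : ∀ f → ∃[ g ] ((IsBase μ g × εbar≡ μ o g j) × neg g ≡ f) → IsBase μ (neg f) × Card (λ s → ¬ Exterior.Active f s) j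
    to _ (g , (gB , inactive) , refl) = subst (IsBase μ) (sym (neg-involutive g)) gB
                                        , Card-⇔ (λ s ¬ext act → ¬ext (subst (λ h → ExternallyActive μ o h s) (neg-involutive g) (exterior-active {neg g} {s} act)))
                                                 (λ s ¬act ext → ¬act (active-exterior {neg g} {s} (subst (λ h → ExternallyActive μ o h s) (sym (neg-involutive g)) ext)))
                                                 inactive
    from : ∀ f → IsBase μ (neg f) × Card (λ s → ¬ Exterior.Active f s) j → ∃[ g ] ((IsBase μ g × εbar≡ μ o g j) × neg g ≡ f)
    from f (fB , inactive) = neg f , (fB , Card-⇔ (λ s ¬act ext → ¬act (active-exterior {f} {s} ext)) (λ s ¬ext act → ¬ext (exterior-active {f} {s} act)) inactive)
                           , neg-involutive f

  delta-card : ∀ {c} → ExteriorCoeffs μ o c → (k : ℕ) → Card (InMinkowski μ k InDelta) (ehrhartSum m c k)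
  delta-card {c} exterior k = Card-⇔ to from (Card-image neg neg-injective (Exterior.count-below c (exterior-coeffs exterior) k))
    where
    flip-depth : ∀ a b → a ≡ b + + k → - b ≡ - a + + k
    flip-depth a b a≡ = trans (shift b (+ k)) (cong (λ x → - x + + k) (sym a≡))
      where
      shift : ∀ b c → - b ≡ - (b + c) + c
      shift = solve-∀
    to : ∀ z → ∃[ w ] (Exterior.Below k w × neg w ≡ z) → InMinkowski μ k InDelta z
    to _ (w , (f , fB , w≤f , depth) , refl) = above⇒delta k (neg w)
      (neg f , fB , neg-mono-≤ᵛ {f = w} {f} w≤f , trans (⟨⊤⟩-neg w) (trans (flip-depth ⟨ ⊤ , f ⟩ ⟨ ⊤ , w ⟩ depth) (cong (_+ + k) (sym (⟨⊤⟩-neg f)))))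
    from : ∀ z → InMinkowski μ k InDelta z → ∃[ w ] (Exterior.Below k w × neg w ≡ z)
    from z mem =
      let g , gB , g≤z , depth = delta⇒above k z mem
      in neg z , (neg g , subst (IsBase μ) (sym (neg-involutive g)) gB , neg-mono-≤ᵛ {f = g} {z} g≤z
                 , trans (⟨⊤⟩-neg g) (trans (flip-depth ⟨ ⊤ , z ⟩ ⟨ ⊤ , g ⟩ depth) (cong (_+ + k) (sym (⟨⊤⟩-neg z)))))
         , neg-involutive z

theorem2p10 : (m : ℕ) (μ : Subset (suc m) → ℤ) → Submodular μ → NonDecreasing μ →
    (o : LinOrd (suc m)) (c c' : ℕ → ℕ) → InteriorCoeffs μ o c → ExteriorCoeffs μ o c' →
    (k : ℕ) →
    Card (InMinkowski μ k InNabla) (ehrhartSum m c k)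
    × Card (InMinkowski μ k InDelta) (ehrhartSum m c' k)
theorem2p10 m μ sub _ o c c′ interior exterior k = nabla-card interior k , delta-card exterior k
  where open Counts μ sub o
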